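{- Let $B(n)=1+\sum_{d\mid n}|\mathrm{cycles}^{(1)}(d)|\,(d+n-2)$ for $n\ge1$. Then $$\frac{B(n)}{(n-1)!}\xrightarrow[n\to\infty]{}2.$$
   Context: Let $n\ge1$. Let $\sigma\in S_n$ be the cycle $\sigma(i)=i+1$ for $i<n$, $\sigma(n)=1$. For $\pi\in S_n$ let $\mathrm{inc}(\pi)=\{\sigma^k\circ\pi:0\le k\le n-1\}$; these sets are the classes of an equivalence relation $\mathcal{R}_2$ on $S_n$ with $(n-1)!$ classes. The map $f(\mathrm{inc}(\pi))=\mathrm{inc}(\pi\circ\sigma)$ is a well-defined permutation of the set of classes. A 1-cycle is an orbit of $f$ (a class fixed by $f$ is a 1-cycle of length 1), and $\mathrm{cycles}^{(1)}(d)$ denotes the set of 1-cycles consisting of exactly $d$ classes. -}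

module Defs where

open import Data.Nat.Base using (ℕ; zero; suc; _+_; _*_; _∸_; _!; _≥_)
open import Data.Nat.DivMod using (_mod_)
open import Data.Nat.Divisibility using (_∣?_)
open import Data.Nat.Properties using (_!≢0)
open import Data.Fin.Base using (Fin; toℕ)
open import Data.Fin.Properties as FinP using ()
open import Data.Vec.Base using (Vec; []; _∷_; tabulate; lookup; toList)
open import Data.Vec.Properties using (≡-dec)
open import Data.List.Base using (List; []; _∷_; [_]; map; concatMap; filter; allFin; upTo; length; deduplicate)
open import Data.List.Relation.Unary.Any using (Any; any?)
open import Data.List.Membership.Propositional using (_∈_)
import Data.List.Relation.Unary.Unique.DecPropositional as UD
import Data.List.Membership.DecPropositional as MD
open import Data.Nat.ListAction using (sum)
open import Data.Integer.Base using (+_)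
open import Data.Rational.Base using (ℚ; _/_)
open import Relation.Binary.Definitions using (Decidable)
open import Relation.Binary.PropositionalEquality using (_≡_)
open import Data.Nat.Properties using (_≟_)

-- A permutation π ∈ S_n is represented by the vector of its values
-- (π(0), …, π(n-1)), positions/values 0-indexed (i ↦ i+1 shift of the paper).
Vecn : ℕ → Set
Vecn n = Vec (Fin n) n

allVecs : (n m : ℕ) → List (Vec (Fin n) m)
allVecs n zero = [ [] ]
allVecs n (suc m) = concatMap (λ i → map (i ∷_) (allVecs n m)) (allFin n)

Sn : (n : ℕ) → List (Vecn n)
Sn n = filter (λ v → UD.unique? FinP._≟_ (toList v)) (allVecs n n)

-- the cycle σ(i) = i+1 (i < n), σ(n) = 1 ; 0-indexed: i ↦ (i+1) mod n
σ : ∀ {n} → Fin n → Fin n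
σ {suc m} i = suc (toℕ i) mod (suc m)

iter : ∀ {A : Set} → ℕ → (A → A) → A → A
iter zero f x = x
iter (suc k) f x = f (iter k f x)

σ^_∘_ : ∀ {n} → ℕ → Vecn n → Vecn n
σ^ k ∘ π = tabulate (λ i → iter k σ (lookup π i))

_∘σ : ∀ {n} → Vecn n → Vecn n
π ∘σ = tabulate (λ i → lookup π (σ i))

inc : ∀ {n} → Vecn n → List (Vecn n)
inc {n} π = map (λ k → σ^ k ∘ π) (upTo n)

R₂ : ∀ {n} → Vecn n → Vecn n → Set
R₂ π π' = π' ∈ inc π

R₂? : ∀ {n} → Decidable (R₂ {n})
R₂? π π' = MD._∈?_ (≡-dec FinP._≟_) π' (inc π)

-- π ∘ σ^k ; the class f^k(inc π) is inc(π ∘ σ^k)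
_∘σ^_ : ∀ {n} → Vecn n → ℕ → Vecn n
π ∘σ^ k = iter k _∘σ π

-- representatives of the classes f^k(inc π), 0 ≤ k < n!  (this covers the whole
-- f-orbit, since an orbit has at most (n-1)! ≤ n! classes)
orbitReps : ∀ {n} → Vecn n → List (Vecn n)
orbitReps {n} π = map (λ k → π ∘σ^ k) (upTo (n !))

orbitSize : ∀ {n} → Vecn n → ℕ
orbitSize π = length (deduplicate R₂? (orbitReps π))

SameOrbit : ∀ {n} → Vecn n → Vecn n → Set
SameOrbit π π' = Any (λ ρ → R₂ ρ π') (orbitReps π)

SameOrbit? : ∀ {n} → Decidable (SameOrbit {n})
SameOrbit? π π' = any? (λ ρ → R₂? ρ π') (orbitReps π)

-- |cycles⁽¹⁾(d)| : number of 1-cycles (f-orbits) consisting of exactly d classes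
-- (one representative permutation kept per orbit)
cycles1 : (n d : ℕ) → ℕ
cycles1 n d = length (deduplicate SameOrbit? (filter (λ π → orbitSize π ≟ d) (Sn n)))

divisors : ℕ → List ℕ
divisors n = filter (_∣? n) (map suc (upTo n))

B : ℕ → ℕ
B n = 1 + sum (map (λ d → cycles1 n d * (d + n ∸ 2)) (divisors n))

ratio : ℕ → ℚ
ratio n = _/_ (+ B n) ((n ∸ 1) !) {{(n ∸ 1) !≢0}}

module Submission where

-- Let ℤ/n × ℤ/n act on S_n by π ↦ σ^a ∘ π ∘ σ^b. The f-orbit of inc(π) consists of the classes
-- inc(σ^a ∘ π ∘ σ^b), so it has n classes exactly when π has no symmetry π ∘ σ^c = σ^j ∘ π with
-- 0 < c < n. A permutation with a symmetry is determined by (c, j) and its first ⌊n/2⌋ values,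
-- so there are at most n^(⌊n/2⌋+2) of them, which is o((n-1)!/n²). All other permutations lie in
-- orbits of exactly n² elements, so the divisor d = n contributes
-- cycles⁽¹⁾(n)(2n-2) = 2(n-1)! + o((n-1)!) to B(n), while every d < n contributes at most 2n
-- per permutation with a symmetry.

open import Defs

module Growth where

  open import Data.Nat.Base
  open import Data.Nat.Properties
  open import Data.Nat.DivMod
  open import Data.Nat.Tactic.RingSolver using (solve-∀)
  open import Data.Unit using (tt)
  open import Relation.Binary.PropositionalEquality
  open import Relation.Nullary using (yes; no)
  open import Relation.Nullary.Decidable using (toWitness)

  n≤n! : ∀ n → n ≤ n !
  n≤n! zero    = z≤n
  n≤n! (suc m) = subst (_≤ suc m !) (*-identityʳ (suc m)) (*-monoʳ-≤ (suc m) (1≤n! m))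

  x*2≡x+x : ∀ x → x * 2 ≡ x + x
  x*2≡x+x = solve-∀

  1+n≤n! : ∀ n → 3 ≤ n → suc n ≤ n !
  1+n≤n! (suc k) 3≤1+k = begin
    suc (suc k)     ≤⟨ +-monoˡ-≤ (suc k) (s≤s (z≤n {k})) ⟩
    suc k + suc k   ≡⟨ x*2≡x+x (suc k) ⟨
    suc k * 2       ≤⟨ *-monoʳ-≤ (suc k) (≤-trans (s≤s⁻¹ 3≤1+k) (n≤n! k)) ⟩
    suc k * k !     ∎
    where open ≤-Reasoning

  [n/2]*2≤n : ∀ n → n / 2 + n / 2 ≤ n
  [n/2]*2≤n n = begin
    n / 2 + n / 2             ≡⟨ x*2≡x+x (n / 2) ⟨
    n / 2 * 2                 ≤⟨ m≤n+m (n / 2 * 2) (n % 2) ⟩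
    n % 2 + n / 2 * 2         ≡⟨ m≡m%n+[m/n]*n n 2 ⟨
    n                         ∎
    where open ≤-Reasoning

  n≤[n/2]*2+1 : ∀ n → n ≤ n / 2 + n / 2 + 1
  n≤[n/2]*2+1 n = begin
    n                         ≡⟨ m≡m%n+[m/n]*n n 2 ⟩
    n % 2 + n / 2 * 2         ≤⟨ +-monoˡ-≤ (n / 2 * 2) (s≤s⁻¹ (m%n<n n 2)) ⟩
    1 + n / 2 * 2             ≡⟨ cong suc (x*2≡x+x (n / 2)) ⟩
    1 + (n / 2 + n / 2)       ≡⟨ +-comm 1 (n / 2 + n / 2) ⟩
    n / 2 + n / 2 + 1         ∎
    where open ≤-Reasoning

  ^-distribʳ-* : ∀ a b k → (a * b) ^ k ≡ a ^ k * b ^ k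
  ^-distribʳ-* a b zero    = refl
  ^-distribʳ-* a b (suc k) = trans (cong (a * b *_) (^-distribʳ-* a b k)) (interchange a b (a ^ k) (b ^ k))
    where
    interchange : ∀ a b x y → a * b * (x * y) ≡ a * x * (b * y)
    interchange = solve-∀

  !*^≤! : ∀ h k → h ! * suc h ^ k ≤ (h + k) !
  !*^≤! h zero    = ≤-reflexive (trans (*-identityʳ (h !)) (cong _! (sym (+-identityʳ h))))
  !*^≤! h (suc k) = begin
    h ! * (suc h * suc h ^ k)   ≡⟨ x*[y*z]≡y*[x*z] (h !) (suc h) (suc h ^ k) ⟩
    suc h * (h ! * suc h ^ k)   ≤⟨ *-mono-≤ (s≤s (m≤m+n h k)) (!*^≤! h k) ⟩
    suc (h + k) * (h + k) !     ≡⟨ cong _! (+-suc h k) ⟨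
    (h + suc k) !               ∎
    where
    open ≤-Reasoning
    x*[y*z]≡y*[x*z] : ∀ x y z → x * (y * z) ≡ y * (x * z)
    x*[y*z]≡y*[x*z] = solve-∀

  !-mono-≤ : ∀ {a b} → a ≤ b → a ! ≤ b !
  !-mono-≤ {a} {b} a≤b = subst (λ c → a ! ≤ c !) (m+[n∸m]≡n a≤b)
    (≤-trans (m≤m*n (a !) (suc a ^ (b ∸ a)) {{m^n≢0 (suc a) (b ∸ a)}}) (!*^≤! a (b ∸ a)))

  2^[5+h]*[1+h]^5≤h! : ∀ h → 63 ≤ h → 2 ^ (5 + h) * suc h ^ 5 ≤ h !
  2^[5+h]*[1+h]^5≤h! (suc h) 63≤1+h with 63 ≟ suc h
  ... | yes refl = toWitness {a? = 2 ^ (5 + 63) * 64 ^ 5 ≤? 63 !} tt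
  ... | no 63≢1+h = begin
    2 * 2 ^ (5 + h) * suc (suc h) ^ 5   ≤⟨ *-monoʳ-≤ (2 * 2 ^ (5 + h)) (^-monoˡ-≤ 5 2+h≤2[1+h]) ⟩
    2 * 2 ^ (5 + h) * (2 * suc h) ^ 5   ≡⟨ cong (2 * 2 ^ (5 + h) *_) (^-distribʳ-* 2 (suc h) 5) ⟩
    2 * 2 ^ (5 + h) * (2 ^ 5 * suc h ^ 5) ≡⟨ regroup (2 ^ (5 + h)) (suc h ^ 5) ⟩
    64 * (2 ^ (5 + h) * suc h ^ 5)      ≤⟨ *-mono-≤ (s≤s 63≤h) (2^[5+h]*[1+h]^5≤h! h 63≤h) ⟩
    suc h * h !                          ∎
    where
    open ≤-Reasoning
    63≤h : 63 ≤ h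
    63≤h = s≤s⁻¹ (≤∧≢⇒< 63≤1+h 63≢1+h)
    2+h≤2[1+h] : suc (suc h) ≤ 2 * suc h
    2+h≤2[1+h] = ≤-trans (+-monoˡ-≤ (suc h) (s≤s (z≤n {h}))) (≤-reflexive (double (suc h)))
      where
      double : ∀ x → x + x ≡ 2 * x
      double = solve-∀
    regroup : ∀ a b → 2 * a * (2 ^ 5 * b) ≡ 64 * (a * b)
    regroup = solve-∀

  -- With h = ⌊n/2⌋ and n = m + 1: n ≤ 2(h+1) bounds the powers of n by powers of h+1, and
  -- h! (h+1)^(h-1) ≤ (2h-1)! ≤ m!.
  poly≤factorial : ∀ h m → 63 ≤ h → h + h ≤ suc m → suc m ≤ h + h + 1 →
    2 * (suc m * suc m) * (suc m * (suc m * suc m ^ h)) ≤ m !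
  poly≤factorial (suc h′) m 63≤h 2h≤n n≤2h+1 = begin
    2 * (n * n) * (n * (n * n ^ h))                  ≡⟨ powers n (n ^ h) ⟩
    2 * n ^ (4 + h)                                   ≤⟨ *-monoʳ-≤ 2 (^-monoˡ-≤ (4 + h) n≤2[1+h]) ⟩
    2 * (2 * suc h) ^ (4 + h)                         ≡⟨ cong (2 *_) (^-distribʳ-* 2 (suc h) (4 + h)) ⟩
    2 * (2 ^ (4 + h) * suc h ^ (5 + h′))              ≡⟨ cong (λ t → 2 * (2 ^ (4 + h) * t)) (^-distribˡ-+-* (suc h) 5 h′) ⟩
    2 * (2 ^ (4 + h) * (suc h ^ 5 * suc h ^ h′))      ≡⟨ regroup (2 ^ (4 + h)) (suc h ^ 5) (suc h ^ h′) ⟩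
    2 ^ (5 + h) * suc h ^ 5 * suc h ^ h′              ≤⟨ *-monoˡ-≤ (suc h ^ h′) (2^[5+h]*[1+h]^5≤h! h 63≤h) ⟩
    h ! * suc h ^ h′                                  ≤⟨ !*^≤! h h′ ⟩
    (h + h′) !                                        ≤⟨ !-mono-≤ (s≤s⁻¹ (subst (_≤ n) (+-suc h h′) 2h≤n)) ⟩
    m !                                               ∎
    where
    open ≤-Reasoning
    h = suc h′
    n = suc m
    powers : ∀ n x → 2 * (n * n) * (n * (n * x)) ≡ 2 * (n * (n * (n * (n * x))))
    powers = solve-∀
    regroup : ∀ a b c → 2 * (a * (b * c)) ≡ 2 * a * b * c
    regroup = solve-∀
    n≤2[1+h] : n ≤ 2 * suc h
    n≤2[1+h] = ≤-trans n≤2h+1 (≤-trans (m≤m+n (h + h + 1) 1) (≤-reflexive (twice h)))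
      where
      twice : ∀ x → x + x + 1 + 1 ≡ 2 * suc x
      twice = solve-∀

module Lists where

  open import Data.Nat.Base
  open import Data.Nat.Properties
  open import Data.List.Base using (List; []; _∷_; map; filter; length; deduplicate; concatMap; cartesianProductWith; _++_)
  open import Data.List.Properties
    using (length-removeAt′; length-++; length-map; filter-++; filter-≐; filter-none; filter-accept; map-cong)
  open import Data.List.Relation.Unary.Any as Any using (Any; here; there; _─_)
  open import Data.List.Relation.Unary.All as All using (All; []; _∷_)
  import Data.List.Relation.Unary.All.Properties as All
  import Data.List.Relation.Unary.Any.Properties as Any
  open import Data.List.Relation.Unary.AllPairs using (AllPairs; []; _∷_)
  import Data.List.Relation.Unary.AllPairs.Properties as AllPairs
  open import Data.List.Membership.Propositional using (_∈_)
  open import Data.List.Relation.Unary.Unique.Propositional using (Unique)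
  open import Data.Nat.Tactic.RingSolver using (solve-∀)
  open import Data.Nat.ListAction using (sum)
  open import Data.Empty using (⊥-elim)
  open import Data.Product using (_×_; _,_; proj₁; proj₂)
  open import Function using (_∘_)
  open import Relation.Nullary using (¬_; Dec; yes; no; ¬?)
  open import Relation.Unary using (Pred; Decidable; _⊆_; _≐_)
  open import Level using (0ℓ)
  import Relation.Binary.Definitions as Rel
  open import Relation.Binary.PropositionalEquality

  private variable
    A C : Set

  Any-─ : ∀ {P Q : Pred C 0ℓ} {ys : List C} (p : Any P ys) →
          (∀ {y} → P y → ¬ Q y) → Any Q ys → Any Q (ys ─ p)
  Any-─ (here py) P⇒¬Q (here qy) = ⊥-elim (P⇒¬Q py qy)
  Any-─ (here _)  _    (there q) = q
  Any-─ (there p) _    (here qy) = here qy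
  Any-─ (there p) P⇒¬Q (there q) = there (Any-─ p P⇒¬Q q)

  -- Pigeonhole principle: y ▷ x reads "y covers x", and no y covers two apart elements.
  length-≤-cover : ∀ {_#_ : A → A → Set} {_▷_ : C → A → Set} (xs : List A) (ys : List C) →
    AllPairs _#_ xs → All (λ x → Any (_▷ x) ys) xs →
    (∀ {y x x′} → y ▷ x → y ▷ x′ → ¬ x # x′) → length xs ≤ length ys
  length-≤-cover []       ys _ _ _ = z≤n
  length-≤-cover (x ∷ xs) ys (x#xs ∷ #xs) (x-covered ∷ xs-covered) once = begin
    suc (length xs)              ≤⟨ s≤s (length-≤-cover xs (ys ─ x-covered) #xs xs-covered′ once) ⟩
    suc (length (ys ─ x-covered)) ≡⟨ length-removeAt′ ys (Any.index x-covered) ⟨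
    length ys                     ∎
    where
    open ≤-Reasoning
    xs-covered′ = All.zipWith
      (λ (x#x′ , x′-covered) → Any-─ x-covered (λ ▷x ▷x′ → once ▷x ▷x′ x#x′) x′-covered) (x#xs , xs-covered)

  Unique-⊆⇒length-≤ : ∀ {xs ys : List A} → Unique xs → (∀ {x} → x ∈ xs → x ∈ ys) → length xs ≤ length ys
  Unique-⊆⇒length-≤ {xs = xs} {ys} u xs⊆ys =
    length-≤-cover xs ys u (All.tabulate (Any.map sym ∘ xs⊆ys)) (λ { refl refl x≢x → x≢x refl })

  AllPairs-restrict : ∀ {R R′ : A → A → Set} {P : Pred A 0ℓ} {xs : List A} →
    (∀ {x y} → P x → P y → R x y → R′ x y) → All P xs → AllPairs R xs → AllPairs R′ xs
  AllPairs-restrict f []       []       = []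
  AllPairs-restrict f (p ∷ ps) (r ∷ rs) =
    All.zipWith (λ (q , s) → f p q s) (ps , r) ∷ AllPairs-restrict f ps rs

  AllPairs-∈-≡ : ∀ {R : A → A → Set} {xs x y} → AllPairs R xs → x ∈ xs → y ∈ xs →
                 ¬ R x y → ¬ R y x → x ≡ y
  AllPairs-∈-≡ (_  ∷ _)  (here refl) (here refl) _ _ = refl
  AllPairs-∈-≡ (Rx ∷ _)  (here refl) (there y∈)  ¬Rxy _ = ⊥-elim (¬Rxy (All.lookup Rx y∈))
  AllPairs-∈-≡ (Ry ∷ _)  (there x∈)  (here refl) _ ¬Ryx = ⊥-elim (¬Ryx (All.lookup Ry x∈))
  AllPairs-∈-≡ (_  ∷ Rs) (there x∈)  (there y∈)  ¬Rxy ¬Ryx = AllPairs-∈-≡ Rs x∈ y∈ ¬Rxy ¬Ryx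

  module _ {R : A → A → Set} (R? : Rel.Decidable R) where

    deduplicate-apart : ∀ xs → AllPairs (λ x y → ¬ R x y) (deduplicate R? xs)
    deduplicate-apart []       = []
    deduplicate-apart (x ∷ xs) =
      All.all-filter (¬? ∘ R? x) (deduplicate R? xs) ∷ AllPairs.filter⁺ (¬? ∘ R? x) (deduplicate-apart xs)

    deduplicate-represents : Rel.Reflexive R → Rel.Transitive R → ∀ {x xs} →
      x ∈ xs → Any (λ y → R y x) (deduplicate R? xs)
    deduplicate-represents refl′ trans′ x∈xs = Any.deduplicate⁺ R? trans′ (Any.map (λ { refl → refl′ }) x∈xs)

  count : {P : Pred A 0ℓ} → Decidable P → List A → ℕ
  count P? = length ∘ filter P?

  module _ {P : Pred A 0ℓ} (P? : Decidable P) where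

    count-+-count-¬ : ∀ xs → count P? xs + count (¬? ∘ P?) xs ≡ length xs
    count-+-count-¬ []       = refl
    count-+-count-¬ (x ∷ xs) with P? x
    ... | yes _ = cong suc (count-+-count-¬ xs)
    ... | no  _ = trans (+-suc _ _) (cong suc (count-+-count-¬ xs))

    count-++ : ∀ xs ys → count P? (xs ++ ys) ≡ count P? xs + count P? ys
    count-++ xs ys = trans (cong length (filter-++ P? xs ys)) (length-++ (filter P? xs))

    count-∷ : ∀ x xs → count P? (x ∷ xs) ≡ count P? (x ∷ []) + count P? xs
    count-∷ x = count-++ (x ∷ [])

    sum-count-singletons : ∀ xs → sum (map (λ x → count P? (x ∷ [])) xs) ≡ count P? xs
    sum-count-singletons []       = refl
    sum-count-singletons (x ∷ xs) = trans (cong (count P? (x ∷ []) +_) (sum-count-singletons xs)) (sym (count-∷ x xs))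

    count-singleton : ∀ {x} → P x → count P? (x ∷ []) ≡ 1
    count-singleton Px = cong length (filter-accept P? Px)

    count-none : ∀ {xs} → All (¬_ ∘ P) xs → count P? xs ≡ 0
    count-none ¬Ps = cong length (filter-none P? ¬Ps)

    count-≐ : ∀ {Q : Pred A 0ℓ} (Q? : Decidable Q) → P ≐ Q → ∀ xs → count P? xs ≡ count Q? xs
    count-≐ Q? P≐Q xs = cong length (filter-≐ P? Q? P≐Q xs)

    count-mono : ∀ {Q : Pred A 0ℓ} (Q? : Decidable Q) → P ⊆ Q → ∀ xs → count P? xs ≤ count Q? xs
    count-mono Q? P⊆Q []       = z≤n
    count-mono Q? P⊆Q (x ∷ xs) with P? x | Q? x
    ... | yes _  | yes _  = s≤s (count-mono Q? P⊆Q xs)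
    ... | yes Px | no ¬Qx = ⊥-elim (¬Qx (P⊆Q Px))
    ... | no _   | yes _  = m≤n⇒m≤1+n (count-mono Q? P⊆Q xs)
    ... | no _   | no _   = count-mono Q? P⊆Q xs

    count-map : ∀ (f : C → A) xs → count P? (map f xs) ≡ count (P? ∘ f) xs
    count-map f []       = refl
    count-map f (x ∷ xs) with P? (f x)
    ... | yes _ = cong suc (count-map f xs)
    ... | no  _ = count-map f xs

    count-concatMap : ∀ (F : C → List A) xs → count P? (concatMap F xs) ≡ sum (map (count P? ∘ F) xs)
    count-concatMap F []       = refl
    count-concatMap F (x ∷ xs) = trans (count-++ (F x) (concatMap F xs)) (cong (count P? (F x) +_) (count-concatMap F xs))

    sum-count-const : ∀ (f : A → ℕ) c → (∀ x → (P x → f x ≡ c) × (¬ P x → f x ≡ 0)) →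
      ∀ xs → sum (map f xs) ≡ c * count P? xs
    sum-count-const f c f≡ []       = sym (*-zeroʳ c)
    sum-count-const f c f≡ (x ∷ xs) with P? x
    ... | yes Px = trans (cong₂ _+_ (proj₁ (f≡ x) Px) (sum-count-const f c f≡ xs)) (sym (*-suc c _))
    ... | no ¬Px = cong₂ _+_ (proj₂ (f≡ x) ¬Px) (sum-count-const f c f≡ xs)

  sum-map-+ : ∀ (f g : A → ℕ) xs → sum (map (λ x → f x + g x) xs) ≡ sum (map f xs) + sum (map g xs)
  sum-map-+ f g []       = refl
  sum-map-+ f g (x ∷ xs) = trans (cong (f x + g x +_) (sum-map-+ f g xs)) (+-+-comm (f x) (g x) _ _)
    where
    +-+-comm : ∀ a b c d → a + b + (c + d) ≡ a + c + (b + d)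
    +-+-comm = solve-∀

  sum-map-* : ∀ k (f : A → ℕ) xs → sum (map (λ x → k * f x) xs) ≡ k * sum (map f xs)
  sum-map-* k f []       = sym (*-zeroʳ k)
  sum-map-* k f (x ∷ xs) = trans (cong (k * f x +_) (sum-map-* k f xs)) (sym (*-distribˡ-+ k (f x) _))

  sum-map-mono : ∀ {f g : A → ℕ} {xs} → All (λ x → f x ≤ g x) xs → sum (map f xs) ≤ sum (map g xs)
  sum-map-mono []         = z≤n
  sum-map-mono (f≤g ∷ ps) = +-mono-≤ f≤g (sum-map-mono ps)

  sum-map-∈ : ∀ (f : A → ℕ) {x xs} → x ∈ xs → f x ≤ sum (map f xs)
  sum-map-∈ f {xs = y ∷ xs} (here refl) = m≤m+n (f y) _
  sum-map-∈ f {xs = y ∷ xs} (there x∈)  = ≤-trans (sum-map-∈ f x∈) (m≤n+m _ (f y))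

  sum-map-≤-except : ∀ {f g : ℕ → ℕ} e {ds} → Unique ds → All (λ d → d ≢ e → f d ≤ g d) ds →
    sum (map f ds) ≤ f e + sum (map g ds)
  sum-map-≤-except e []          []            = z≤n
  sum-map-≤-except {f} {g} e {d ∷ ds} (d∉ds ∷ u) (fd≤ ∷ fds≤) with d ≟ e
  ... | yes refl = +-monoʳ-≤ (f d)
    (≤-trans (sum-map-mono (All.zipWith (λ (d≢d′ , ≤g) → ≤g (≢-sym d≢d′)) (d∉ds , fds≤))) (m≤n+m _ (g d)))
  ... | no d≢e = ≤-trans (+-mono-≤ (fd≤ d≢e) (sum-map-≤-except e u fds≤)) (≤-reflexive (x+[y+z]≡y+[x+z] (g d) (f e) _))
    where
    x+[y+z]≡y+[x+z] : ∀ x y z → x + (y + z) ≡ y + (x + z)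
    x+[y+z]≡y+[x+z] = solve-∀

  sum-count-swap : ∀ {R : A → C → Set} (R? : ∀ i v → Dec (R i v)) is vs →
    sum (map (λ i → count (R? i) vs) is) ≡ sum (map (λ v → count (λ i → R? i v) is) vs)
  sum-count-swap R? is []       = sum-map-zero is
    where
    sum-map-zero : ∀ (xs : List A) → sum (map (λ _ → 0) xs) ≡ 0
    sum-map-zero []       = refl
    sum-map-zero (_ ∷ xs) = sum-map-zero xs
  sum-count-swap R? is (v ∷ vs) = begin
    sum (map (λ i → count (R? i) (v ∷ vs)) is)
      ≡⟨ cong sum (map-cong (λ i → count-∷ (R? i) v vs) is) ⟩
    sum (map (λ i → count (R? i) (v ∷ []) + count (R? i) vs) is)
      ≡⟨ sum-map-+ _ _ is ⟩
    sum (map (λ i → count (R? i) (v ∷ [])) is) + sum (map (λ i → count (R? i) vs) is)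
      ≡⟨ cong₂ _+_ (column is) (sum-count-swap R? is vs) ⟩
    count (λ i → R? i v) is + sum (map (λ v → count (λ i → R? i v) is) vs) ∎
    where
    open ≡-Reasoning
    column : ∀ is → sum (map (λ i → count (R? i) (v ∷ [])) is) ≡ count (λ i → R? i v) is
    column []       = refl
    column (i ∷ is) with R? i v
    ... | yes _ = cong suc (column is)
    ... | no  _ = column is

  concatMap-map : ∀ {D : Set} (f : A → C → D) xs ys →
    concatMap (λ x → map (f x) ys) xs ≡ cartesianProductWith f xs ys
  concatMap-map f []       ys = refl
  concatMap-map f (x ∷ xs) ys = cong (map (f x) ys ++_) (concatMap-map f xs ys)

  length-cartesianProductWith : ∀ {D : Set} (f : A → C → D) xs ys →
    length (cartesianProductWith f xs ys) ≡ length xs * length ys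
  length-cartesianProductWith f []       ys = refl
  length-cartesianProductWith f (x ∷ xs) ys = trans (length-++ (map (f x) ys))
    (cong₂ _+_ (length-map (f x) ys) (length-cartesianProductWith f xs ys))

module Rotations where

  open Growth using (n≤n!)
  open import Data.Nat.Base
  open import Data.Nat.Properties
  open import Data.Nat.DivMod
  open import Data.Fin.Base using (Fin; toℕ; zero)
  open import Data.Fin.Properties using (toℕ-injective; toℕ<n; toℕ-fromℕ<)
  open import Data.Vec.Base using (tabulate; lookup)
  open import Data.Vec.Properties using (lookup∘tabulate; tabulate∘lookup; tabulate-cong)
  open import Data.List.Membership.Propositional using (_∈_; lose; find)
  open import Data.List.Membership.Propositional.Properties using (∈-map⁻; ∈-map⁺; ∈-upTo⁺; ∈-upTo⁻)
  open import Data.Product using (∃; ∃₂; _×_; _,_)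
  open import Function using (_∘_)
  open import Relation.Binary.PropositionalEquality

  iter-+ : ∀ {A : Set} (f : A → A) a b x → iter (a + b) f x ≡ iter a f (iter b f x)
  iter-+ f zero    b x = refl
  iter-+ f (suc a) b x = cong f (iter-+ f a b x)

  iter-commute : ∀ {A : Set} (f : A → A) k x → iter k f (f x) ≡ f (iter k f x)
  iter-commute f zero    x = refl
  iter-commute f (suc k) x = cong f (iter-commute f k x)

  module _ {m : ℕ} where

    private
      n : ℕ
      n = suc m

    rot : ℕ → Fin n → Fin n
    rot k = iter k σ

    private
      %-absorbʳ : ∀ a b → (a + b % n) % n ≡ (a + b) % n
      %-absorbʳ a b = begin
        (a + b % n) % n         ≡⟨ %-distribˡ-+ a (b % n) n ⟩
        (a % n + b % n % n) % n ≡⟨ cong (λ t → (a % n + t) % n) (m%n%n≡m%n b n) ⟩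
        (a % n + b % n) % n     ≡⟨ %-distribˡ-+ a b n ⟨
        (a + b) % n             ∎
        where open ≡-Reasoning

    toℕ-rot : ∀ k x → toℕ (rot k x) ≡ (toℕ x + k) % n
    toℕ-rot zero    x = sym (trans (cong (_% n) (+-identityʳ (toℕ x))) (m<n⇒m%n≡m (toℕ<n x)))
    toℕ-rot (suc k) x = begin
      toℕ (σ (rot k x))         ≡⟨ toℕ-fromℕ< _ ⟩
      suc (toℕ (rot k x)) % n   ≡⟨ cong (λ t → suc t % n) (toℕ-rot k x) ⟩
      (1 + (toℕ x + k) % n) % n ≡⟨ %-absorbʳ 1 (toℕ x + k) ⟩
      (1 + (toℕ x + k)) % n     ≡⟨ cong (_% n) (+-suc (toℕ x) k) ⟨
      (toℕ x + suc k) % n       ∎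
      where open ≡-Reasoning

    rot-mod : ∀ a b x → a % n ≡ b % n → rot a x ≡ rot b x
    rot-mod a b x a≡b = toℕ-injective (begin
      toℕ (rot a x)       ≡⟨ toℕ-rot a x ⟩
      (toℕ x + a) % n     ≡⟨ %-absorbʳ (toℕ x) a ⟨
      (toℕ x + a % n) % n ≡⟨ cong (λ t → (toℕ x + t) % n) a≡b ⟩
      (toℕ x + b % n) % n ≡⟨ %-absorbʳ (toℕ x) b ⟩
      (toℕ x + b) % n     ≡⟨ toℕ-rot b x ⟨
      toℕ (rot b x)       ∎)
      where open ≡-Reasoning

    toℕ-rot-wrap : ∀ {k} x → k ≤ n → n ≤ toℕ x + k → toℕ (rot k x) ≡ toℕ x + k ∸ n
    toℕ-rot-wrap {k} x k≤n n≤x+k = begin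
      toℕ (rot k x)              ≡⟨ toℕ-rot k x ⟩
      (toℕ x + k) % n            ≡⟨ cong (_% n) (m∸n+n≡m n≤x+k) ⟨
      (toℕ x + k ∸ n + n) % n    ≡⟨ [m+n]%n≡m%n (toℕ x + k ∸ n) n ⟩
      (toℕ x + k ∸ n) % n        ≡⟨ m<n⇒m%n≡m x+k∸n<n ⟩
      toℕ x + k ∸ n              ∎
      where
      open ≡-Reasoning
      x+k∸n<n : toℕ x + k ∸ n < n
      x+k∸n<n = +-cancelʳ-< n _ n (subst (_< n + n) (sym (m∸n+n≡m n≤x+k)) (+-mono-<-≤ (toℕ<n x) k≤n))

    rot-% : ∀ k x → rot (k % n) x ≡ rot k x
    rot-% k x = rot-mod (k % n) k x (m%n%n≡m%n k n)

    rot-+ : ∀ a b x → rot a (rot b x) ≡ rot (a + b) x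
    rot-+ a b x = sym (iter-+ σ a b x)

    rot-n : ∀ x → rot n x ≡ x
    rot-n x = rot-mod n 0 x (n%n≡0 n)

    rot-comm : ∀ a b x → rot a (rot b x) ≡ rot b (rot a x)
    rot-comm a b x = trans (rot-+ a b x) (trans (cong (λ t → rot t x) (+-comm a b)) (sym (rot-+ b a x)))

    rot⁻ : ℕ → ℕ
    rot⁻ k = n ∸ k % n

    rot-inverseˡ : ∀ k x → rot (rot⁻ k) (rot k x) ≡ x
    rot-inverseˡ k x = trans (rot-+ (rot⁻ k) k x) (rot-mod (rot⁻ k + k) 0 x (begin
      (rot⁻ k + k) % n         ≡⟨ %-absorbʳ (rot⁻ k) k ⟨
      (n ∸ k % n + k % n) % n ≡⟨ cong (_% n) (m∸n+n≡m (<⇒≤ (m%n<n k n))) ⟩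
      n % n                    ≡⟨ n%n≡0 n ⟩
      0                        ∎))
      where open ≡-Reasoning

    rot-inverseʳ : ∀ k x → rot k (rot (rot⁻ k) x) ≡ x
    rot-inverseʳ k x = trans (rot-comm k (rot⁻ k) x) (rot-inverseˡ k x)

    rot-∸ : ∀ {b b′} z → b ≤ b′ → rot (b′ ∸ b) z ≡ rot b′ (rot (rot⁻ b) z)
    rot-∸ {b} {b′} z b≤b′ = begin
      rot (b′ ∸ b) z                        ≡⟨ cong (rot (b′ ∸ b)) (rot-inverseʳ b z) ⟨
      rot (b′ ∸ b) (rot b (rot (rot⁻ b) z)) ≡⟨ rot-+ (b′ ∸ b) b _ ⟩
      rot (b′ ∸ b + b) (rot (rot⁻ b) z)     ≡⟨ cong (λ k → rot k (rot (rot⁻ b) z)) (m∸n+n≡m b≤b′) ⟩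
      rot b′ (rot (rot⁻ b) z)               ∎
      where open ≡-Reasoning

    rot-injective : ∀ k {x y} → rot k x ≡ rot k y → x ≡ y
    rot-injective k {x} {y} eq =
      trans (sym (rot-inverseˡ k x)) (trans (cong (rot (rot⁻ k)) eq) (rot-inverseˡ k y))

    rot-injectiveˡ : ∀ {a b} z → a < n → b < n → rot a z ≡ rot b z → a ≡ b
    rot-injectiveˡ {a} {b} z a<n b<n eq = begin
      a                   ≡⟨ m<n⇒m%n≡m a<n ⟨
      a % n               ≡⟨ toℕ-rot a zero ⟨
      toℕ (rot a zero)    ≡⟨ cong toℕ (rot-injective (toℕ z) (begin
        rot (toℕ z) (rot a zero) ≡⟨ rot-comm (toℕ z) a zero ⟩
        rot a (rot (toℕ z) zero) ≡⟨ cong (rot a) z₀≡z ⟩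
        rot a z                  ≡⟨ eq ⟩
        rot b z                  ≡⟨ cong (rot b) z₀≡z ⟨
        rot b (rot (toℕ z) zero) ≡⟨ rot-comm b (toℕ z) zero ⟩
        rot (toℕ z) (rot b zero) ∎)) ⟩
      toℕ (rot b zero)    ≡⟨ toℕ-rot b zero ⟩
      b % n               ≡⟨ m<n⇒m%n≡m b<n ⟩
      b                   ∎
      where
      open ≡-Reasoning
      z₀≡z : rot (toℕ z) zero ≡ z
      z₀≡z = toℕ-injective (trans (toℕ-rot (toℕ z) zero) (m<n⇒m%n≡m (toℕ<n z)))

    lookup-σ^∘ : ∀ a (π : Vecn n) i → lookup (σ^ a ∘ π) i ≡ rot a (lookup π i)
    lookup-σ^∘ a π = lookup∘tabulate (λ i → rot a (lookup π i))

    lookup-∘σ^ : ∀ b (π : Vecn n) i → lookup (π ∘σ^ b) i ≡ lookup π (rot b i)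
    lookup-∘σ^ zero    π i = refl
    lookup-∘σ^ (suc b) π i = begin
      lookup ((π ∘σ^ b) ∘σ) i ≡⟨ lookup∘tabulate (λ i → lookup (π ∘σ^ b) (σ i)) i ⟩
      lookup (π ∘σ^ b) (σ i)  ≡⟨ lookup-∘σ^ b π (σ i) ⟩
      lookup π (rot b (σ i))  ≡⟨ cong (lookup π) (iter-commute σ b i) ⟩
      lookup π (rot (suc b) i) ∎
      where open ≡-Reasoning

    record Twist (π : Vecn n) (a b : ℕ) (π′ : Vecn n) : Set where
      constructor twisted
      field at : ∀ i → lookup π′ i ≡ rot a (lookup π (rot b i))
    open Twist public

    twist : Vecn n → ℕ → ℕ → Vecn n
    twist π a b = tabulate (λ i → rot a (lookup π (rot b i)))

    twist-Twist : ∀ π a b → Twist π a b (twist π a b)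
    twist-Twist π a b = twisted (lookup∘tabulate (λ i → rot a (lookup π (rot b i))))

    Twist⇒≡twist : ∀ {π a b π′} → Twist π a b π′ → π′ ≡ twist π a b
    Twist⇒≡twist {π′ = π′} t = trans (sym (tabulate∘lookup π′)) (tabulate-cong (at t))

    Twist-refl : ∀ {π} → Twist π 0 0 π
    Twist-refl = twisted λ i → refl

    Twist-trans : ∀ {π a b π′ a′ b′ π″} → Twist π a b π′ → Twist π′ a′ b′ π″ →
                  Twist π (a′ + a) (b + b′) π″
    Twist-trans {π} {a} {b} {π′} {a′} {b′} {π″} t t′ = twisted λ i → begin
      lookup π″ i                         ≡⟨ at t′ i ⟩
      rot a′ (lookup π′ (rot b′ i))       ≡⟨ cong (rot a′) (at t (rot b′ i)) ⟩
      rot a′ (rot a (lookup π (rot b (rot b′ i)))) ≡⟨ rot-+ a′ a _ ⟩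
      rot (a′ + a) (lookup π (rot b (rot b′ i))) ≡⟨ cong (λ j → rot (a′ + a) (lookup π j)) (rot-+ b b′ i) ⟩
      rot (a′ + a) (lookup π (rot (b + b′) i)) ∎
      where open ≡-Reasoning

    Twist-sym : ∀ {π a b π′} → Twist π a b π′ → Twist π′ (rot⁻ a) (rot⁻ b) π
    Twist-sym {π} {a} {b} {π′} t = twisted λ i → begin
      lookup π i                                               ≡⟨ rot-inverseˡ a _ ⟨
      rot (rot⁻ a) (rot a (lookup π i))                        ≡⟨ cong (rot (rot⁻ a) ∘ rot a ∘ lookup π) (rot-inverseʳ b i) ⟨
      rot (rot⁻ a) (rot a (lookup π (rot b (rot (rot⁻ b) i)))) ≡⟨ cong (rot (rot⁻ a)) (at t (rot (rot⁻ b) i)) ⟨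
      rot (rot⁻ a) (lookup π′ (rot (rot⁻ b) i))                ∎
      where open ≡-Reasoning

    Twist-% : ∀ {π a b π′} → Twist π a b π′ → Twist π (a % n) (b % n) π′
    Twist-% {π} {a} {b} t = twisted λ i →
      trans (at t i) (sym (trans (rot-% a _) (cong (rot a ∘ lookup π) (rot-% b i))))

    R₂⇒Twist : ∀ {π π′ : Vecn n} → R₂ π π′ → ∃ λ a → a < n × Twist π a 0 π′
    R₂⇒Twist {π} {π′} r with a , a∈ , π′≡ ← ∈-map⁻ (λ k → σ^ k ∘ π) r =
      a , ∈-upTo⁻ a∈ , twisted λ i → trans (cong (λ ρ → lookup ρ i) π′≡) (lookup-σ^∘ a π i)

    Twist⇒R₂ : ∀ {π π′ : Vecn n} {a} → Twist π a 0 π′ → R₂ π π′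
    Twist⇒R₂ {π} {π′} {a} t = subst (_∈ inc π) (sym π′≡) (∈-map⁺ (λ k → σ^ k ∘ π) (∈-upTo⁺ (m%n<n a n)))
      where
      π′≡ : π′ ≡ σ^ (a % n) ∘ π
      π′≡ = trans (Twist⇒≡twist (Twist-% t))
                  (sym (Twist⇒≡twist {π} {a % n} {0} (twisted (lookup-σ^∘ (a % n) π))))

    R₂-refl : ∀ π → R₂ π π
    R₂-refl π = Twist⇒R₂ (Twist-refl {π})

    R₂-sym : ∀ π π′ → R₂ π π′ → R₂ π′ π
    R₂-sym π π′ r with a , _ , t ← R₂⇒Twist {π} {π′} r =
      Twist⇒R₂ (subst (λ b → Twist π′ (rot⁻ a % n) b π) (n%n≡0 n) (Twist-% (Twist-sym t)))

    R₂-trans : ∀ π π′ π″ → R₂ π π′ → R₂ π′ π″ → R₂ π π″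
    R₂-trans π π′ π″ r r′ with _ , _ , t ← R₂⇒Twist {π} {π′} r | _ , _ , t′ ← R₂⇒Twist {π′} {π″} r′ =
      Twist⇒R₂ (Twist-trans t t′)

    SameOrbit⇒Twist : ∀ {π π′ : Vecn n} → SameOrbit π π′ → ∃₂ λ a b → a < n × b < n × Twist π a b π′
    SameOrbit⇒Twist {π} so
      with ρ , ρ∈ , r ← find so
      with k , _ , refl ← ∈-map⁻ (λ k → π ∘σ^ k) ρ∈
      with a , _ , t ← R₂⇒Twist {π ∘σ^ k} r =
      a % n , k % n , m%n<n a n , m%n<n k n ,
      Twist-% {π} {a} {k} (twisted λ i → trans (at t i) (cong (rot a) (lookup-∘σ^ k π i)))

    Twist⇒SameOrbit : ∀ {π π′ : Vecn n} {a b} → Twist π a b π′ → SameOrbit π π′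
    Twist⇒SameOrbit {π} {π′} {a} {b} t =
      lose (∈-map⁺ (λ k → π ∘σ^ k) (∈-upTo⁺ (≤-trans (m%n<n b n) (n≤n! n))))
           (Twist⇒R₂ {π ∘σ^ (b % n)} {a = a % n} (twisted λ i →
             trans (at (Twist-% t) i) (cong (rot (a % n)) (sym (lookup-∘σ^ (b % n) π i)))))

    SameOrbit-refl : ∀ π → SameOrbit π π
    SameOrbit-refl π = Twist⇒SameOrbit (Twist-refl {π})

    SameOrbit-trans : ∀ π π′ π″ → SameOrbit π π′ → SameOrbit π′ π″ → SameOrbit π π″
    SameOrbit-trans π π′ π″ s s′
      with _ , _ , _ , _ , t ← SameOrbit⇒Twist {π} {π′} s | _ , _ , _ , _ , t′ ← SameOrbit⇒Twist {π′} {π″} s′ =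
      Twist⇒SameOrbit (Twist-trans t t′)

module OrbitSizes where

  open Growth using (n≤n!)
  open Lists
  open Rotations
  open import Data.Nat.Base
  open import Data.Nat.Properties
  open import Data.Nat.DivMod
  import Data.Fin.Properties as Fin
  open import Data.Vec.Base using (lookup)
  open import Data.List.Base using (upTo; deduplicate)
  open import Data.List.Properties using (length-upTo)
  open import Data.List.Relation.Unary.All as All using (All)
  open import Data.List.Relation.Unary.Any using (Any)
  import Data.List.Relation.Unary.Unique.Propositional.Properties as Unique
  open import Data.List.Membership.Propositional using (_∈_; lose)
  open import Data.List.Membership.Propositional.Properties using (∈-map⁻; ∈-map⁺; ∈-upTo⁺; ∈-upTo⁻; ∈-deduplicate⁻)
  open import Data.Empty using (⊥; ⊥-elim)
  open import Data.Product using (∃; _×_; _,_)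
  open import Function using (_∘_)
  open import Relation.Binary.Definitions using (tri<; tri≈; tri>)
  open import Relation.Nullary using (¬_; Dec; yes; no)
  open import Relation.Nullary.Decidable using (_×-dec_)
  open import Relation.Binary.PropositionalEquality

  module _ {m : ℕ} where

    private
      n : ℕ
      n = suc m

    Equivariant : Vecn n → ℕ → ℕ → Set
    Equivariant π c j = ∀ i → lookup π (rot c i) ≡ rot j (lookup π i)

    Equivariant-trivial : ∀ π → Equivariant π n 0
    Equivariant-trivial π i = cong (lookup π) (rot-n i)

    Equivariant-* : ∀ π c j → Equivariant π c j → ∀ q r i →
      lookup π (rot (q * c + r) i) ≡ rot (q * j) (lookup π (rot r i))
    Equivariant-* π c j eq zero    r i = refl
    Equivariant-* π c j eq (suc q) r i = begin
      lookup π (rot (c + q * c + r) i)                ≡⟨ cong (λ k → lookup π (rot k i)) (+-assoc c (q * c) r) ⟩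
      lookup π (rot (c + (q * c + r)) i)              ≡⟨ cong (lookup π) (rot-+ c (q * c + r) i) ⟨
      lookup π (rot c (rot (q * c + r) i))            ≡⟨ eq _ ⟩
      rot j (lookup π (rot (q * c + r) i))            ≡⟨ cong (rot j) (Equivariant-* π c j eq q r i) ⟩
      rot j (rot (q * j) (lookup π (rot r i)))        ≡⟨ rot-+ j (q * j) _ ⟩
      rot (j + q * j) (lookup π (rot r i))            ∎
      where open ≡-Reasoning

    orbitSize≤period : ∀ π c j .{{_ : NonZero c}} → Equivariant π c j → orbitSize π ≤ c
    orbitSize≤period π c j eq = subst (_ ≤_) (length-upTo c)
      (length-≤-cover (deduplicate R₂? (orbitReps π)) (upTo c)
        (deduplicate-apart R₂? (orbitReps π)) (All.tabulate covered)
        (λ {r} {ρ} {ρ′} ▷ρ ▷ρ′ ¬ρ~ρ′ →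
           ¬ρ~ρ′ (R₂-trans ρ (π ∘σ^ r) ρ′ (R₂-sym (π ∘σ^ r) ρ ▷ρ) ▷ρ′)))
      where
      covered : ∀ {ρ} → ρ ∈ deduplicate R₂? (orbitReps π) → Any (λ r → R₂ (π ∘σ^ r) ρ) (upTo c)
      covered ρ∈ with k , _ , refl ← ∈-map⁻ (λ k → π ∘σ^ k) (∈-deduplicate⁻ R₂? (orbitReps π) ρ∈) =
        lose (∈-upTo⁺ (m%n<n k c)) (Twist⇒R₂ {π = π ∘σ^ (k % c)} {a = k / c * j} (twisted λ i → begin
          lookup (π ∘σ^ k) i                        ≡⟨ lookup-∘σ^ k π i ⟩
          lookup π (rot k i)                        ≡⟨ cong (λ t → lookup π (rot t i)) k≡ ⟩
          lookup π (rot (k / c * c + k % c) i)      ≡⟨ Equivariant-* π c j eq (k / c) (k % c) i ⟩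
          rot (k / c * j) (lookup π (rot (k % c) i)) ≡⟨ cong (rot (k / c * j)) (lookup-∘σ^ (k % c) π i) ⟨
          rot (k / c * j) (lookup (π ∘σ^ (k % c)) i) ∎))
        where
        open ≡-Reasoning
        k≡ : k ≡ k / c * c + k % c
        k≡ = trans (m≡m%n+[m/n]*n k c) (+-comm (k % c) _)

    orbitSize≤n : ∀ π → orbitSize π ≤ n
    orbitSize≤n π = orbitSize≤period π n 0 (Equivariant-trivial π)

    R₂-shift⇒Equivariant : ∀ π {k k′} → k ≤ k′ → R₂ (π ∘σ^ k) (π ∘σ^ k′) →
                           ∃ λ a → Equivariant π (k′ ∸ k) a
    R₂-shift⇒Equivariant π {k} {k′} k≤k′ r with a , _ , t ← R₂⇒Twist {π = π ∘σ^ k} r = a , λ z →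
      let i = rot (rot⁻ k) z in begin
      lookup π (rot (k′ ∸ k) z)      ≡⟨ cong (lookup π) (rot-∸ z k≤k′) ⟩
      lookup π (rot k′ i)            ≡⟨ lookup-∘σ^ k′ π i ⟨
      lookup (π ∘σ^ k′) i            ≡⟨ at t i ⟩
      rot a (lookup (π ∘σ^ k) i)     ≡⟨ cong (rot a) (lookup-∘σ^ k π i) ⟩
      rot a (lookup π (rot k i))     ≡⟨ cong (rot a ∘ lookup π) (rot-inverseʳ k z) ⟩
      rot a (lookup π z)             ∎
      where open ≡-Reasoning

    Symmetric : Vecn n → Set
    Symmetric π = ∃ λ c → c < n × (0 < c × ∃ λ j → j < n × Equivariant π c j)

    symmetric? : ∀ π → Dec (Symmetric π)
    symmetric? π = anyUpTo? (λ c → 0 <? c ×-dec anyUpTo? (λ j → equivariant? c j) n) n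
      where
      equivariant? : ∀ c j → Dec (Equivariant π c j)
      equivariant? c j = Fin.all? λ i → lookup π (rot c i) Fin.≟ rot j (lookup π i)

    symmetric : ∀ π c j → 0 < c → c < n → Equivariant π c j → Symmetric π
    symmetric π c j 0<c c<n eq = c , c<n , 0<c , j % n , m%n<n j n , λ i → trans (eq i) (sym (rot-% j _))

    n≤orbitSize : ∀ π → ¬ Symmetric π → n ≤ orbitSize π
    n≤orbitSize π ¬sym = subst (_≤ orbitSize π) (length-upTo n)
      (length-≤-cover (upTo n) (deduplicate R₂? (orbitReps π))
        (AllPairs-restrict (λ k<n k′<n k≢k′ → k≢k′ , k<n , k′<n) (All.tabulate ∈-upTo⁻) (Unique.upTo⁺ n))
        (All.tabulate λ k∈ →
          deduplicate-represents R₂? (λ {ρ} → R₂-refl ρ) (λ {ρ ρ′ ρ″} → R₂-trans ρ ρ′ ρ″)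
          (∈-map⁺ (λ k → π ∘σ^ k) (∈-upTo⁺ (≤-trans (∈-upTo⁻ k∈) (n≤n! n)))))
        (λ {ρ} {k} {k′} r r′ (k≢k′ , k<n , k′<n) →
           distinct k k′ (R₂-trans (π ∘σ^ k) ρ (π ∘σ^ k′) (R₂-sym ρ (π ∘σ^ k) r) r′)
                         (R₂-trans (π ∘σ^ k′) ρ (π ∘σ^ k) (R₂-sym ρ (π ∘σ^ k′) r′) r) k≢k′ k<n k′<n))
      where
      shift : ∀ k k′ → k < k′ → k′ < n → ¬ R₂ (π ∘σ^ k) (π ∘σ^ k′)
      shift k k′ k<k′ k′<n r with a , eq ← R₂-shift⇒Equivariant π {k} {k′} (<⇒≤ k<k′) r =
        ¬sym (symmetric π (k′ ∸ k) a (m<n⇒0<n∸m k<k′) (≤-<-trans (m∸n≤m k′ k) k′<n) eq)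
      distinct : ∀ k k′ → R₂ (π ∘σ^ k) (π ∘σ^ k′) → R₂ (π ∘σ^ k′) (π ∘σ^ k) →
                 k ≢ k′ → k < n → k′ < n → ⊥
      distinct k k′ r r′ k≢k′ k<n k′<n with <-cmp k k′
      ... | tri< k<k′ _ _ = shift k k′ k<k′ k′<n r
      ... | tri≈ _ k≡k′ _ = k≢k′ k≡k′
      ... | tri> _ _ k′<k = shift k′ k k′<k k<n r′

    orbitSize≢n⇒Symmetric : ∀ π → orbitSize π ≢ n → Symmetric π
    orbitSize≢n⇒Symmetric π ≢n with symmetric? π
    ... | yes sym = sym
    ... | no ¬sym = ⊥-elim (≢n (≤-antisym (orbitSize≤n π) (n≤orbitSize π ¬sym)))

module Permutations where

  open Lists
  open import Data.Nat.Base
  open import Data.Nat.Properties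
  open import Data.Fin.Base using (Fin; zero; suc)
  import Data.Fin.Properties as Fin
  open import Data.Vec.Base using (Vec; []; _∷_; lookup; toList)
  open import Data.Vec.Properties using (∷-injective; length-toList)
  open import Data.Vec.Membership.Propositional.Properties using (∈-lookup; ∈-toList⁺; ∈-toList⁻)
  open import Data.Vec.Relation.Unary.Any.Properties using (lookup-index)
  open import Data.List.Base using (List; map; filter; length; allFin; cartesianProductWith)
  open import Data.List.Properties using (length-tabulate; map-cong)
  open import Data.List.Relation.Unary.Any using (here)
  open import Data.List.Relation.Unary.All as All using ([])
  open import Data.List.Relation.Unary.All.Properties using (All¬⇒¬Any; ¬Any⇒All¬)
  open import Data.List.Relation.Unary.AllPairs using ([]; _∷_)
  open import Data.List.Relation.Unary.Unique.Propositional using (Unique)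
  import Data.List.Relation.Unary.Unique.Propositional.Properties as Unique
  import Data.List.Relation.Unary.Unique.DecPropositional as UniqueDec
  open import Data.List.Membership.Propositional using (_∈_; _∉_)
  open import Data.List.Membership.Propositional.Properties
    using (∈-filter⁺; ∈-filter⁻; ∈-allFin; ∈-cartesianProductWith⁺)
  import Data.List.Membership.DecPropositional as MembershipDec
  open import Data.Nat.ListAction using (sum)
  open import Data.Empty using (⊥-elim)
  open import Data.Product using (_×_; _,_; proj₁; proj₂)
  open import Function using (_∘_)
  open import Relation.Nullary using (Dec; ¬?)
  open import Relation.Nullary.Decidable using (_×-dec_)
  open import Relation.Unary using (_≐_)
  open import Relation.Binary.PropositionalEquality

  private variable
    A : Set
    k : ℕ

  LookupInjective : Vec A k → Set
  LookupInjective v = ∀ {i j} → lookup v i ≡ lookup v j → i ≡ j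

  Unique⇒LookupInjective : ∀ (v : Vec A k) → Unique (toList v) → LookupInjective v
  Unique⇒LookupInjective (x ∷ v) (x∉ ∷ u) {zero}  {zero}  eq = refl
  Unique⇒LookupInjective (x ∷ v) (x∉ ∷ u) {zero}  {suc j} eq = ⊥-elim (All.lookup x∉ (∈-toList⁺ (∈-lookup j v)) eq)
  Unique⇒LookupInjective (x ∷ v) (x∉ ∷ u) {suc i} {zero}  eq = ⊥-elim (All.lookup x∉ (∈-toList⁺ (∈-lookup i v)) (sym eq))
  Unique⇒LookupInjective (x ∷ v) (x∉ ∷ u) {suc i} {suc j} eq = cong suc (Unique⇒LookupInjective v u eq)

  LookupInjective⇒Unique : ∀ (v : Vec A k) → LookupInjective v → Unique (toList v)
  LookupInjective⇒Unique []      inj = []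
  LookupInjective⇒Unique (x ∷ v) inj = All.tabulate x∉ ∷ LookupInjective⇒Unique v (Fin.suc-injective ∘ inj)
    where
    x∉ : ∀ {y} → y ∈ toList v → x ≢ y
    x∉ y∈ x≡y = let y∈v = ∈-toList⁻ y∈ in Fin.0≢1+n (inj (trans x≡y (lookup-index y∈v)))

  allVecs≡ : ∀ n k → allVecs n (suc k) ≡ cartesianProductWith _∷_ (allFin n) (allVecs n k)
  allVecs≡ n k = concatMap-map _∷_ (allFin n) (allVecs n k)

  ∈-allVecs : ∀ n (v : Vec (Fin n) k) → v ∈ allVecs n k
  ∈-allVecs n []              = here refl
  ∈-allVecs {suc k} n (x ∷ v) =
    subst (_ ∈_) (sym (allVecs≡ n k)) (∈-cartesianProductWith⁺ _∷_ (∈-allFin x) (∈-allVecs n v))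

  allVecs-unique : ∀ n k → Unique (allVecs n k)
  allVecs-unique n zero    = [] ∷ []
  allVecs-unique n (suc k) = subst Unique (sym (allVecs≡ n k))
    (Unique.cartesianProductWith⁺ _∷_ ∷-injective (Unique.allFin⁺ n) (allVecs-unique n k))

  length-allVecs : ∀ n k → length (allVecs n k) ≡ n ^ k
  length-allVecs n zero    = refl
  length-allVecs n (suc k) = begin
    length (allVecs n (suc k))                                  ≡⟨ cong length (allVecs≡ n k) ⟩
    length (cartesianProductWith _∷_ (allFin n) (allVecs n k))  ≡⟨ length-cartesianProductWith _∷_ (allFin n) _ ⟩
    length (allFin n) * length (allVecs n k)
      ≡⟨ cong₂ _*_ (length-tabulate {n = n} (λ i → i)) (length-allVecs n k) ⟩
    n * n ^ k                                                   ∎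
    where open ≡-Reasoning

  private
    unique? : ∀ {n} (v : Vec (Fin n) k) → Dec (Unique (toList v))
    unique? v = UniqueDec.unique? Fin._≟_ (toList v)

  ∈-Sn⁺ : ∀ {n} (v : Vecn n) → LookupInjective v → v ∈ Sn n
  ∈-Sn⁺ {n} v inj = ∈-filter⁺ unique? (∈-allVecs n v) (LookupInjective⇒Unique v inj)

  ∈-Sn⁻ : ∀ {n} {v : Vecn n} → v ∈ Sn n → LookupInjective v
  ∈-Sn⁻ {n} {v} v∈ = Unique⇒LookupInjective v (proj₂ (∈-filter⁻ unique? {xs = allVecs n n} v∈))

  Sn-unique : ∀ n → Unique (Sn n)
  Sn-unique n = Unique.filter⁺ unique? (allVecs-unique n n)

  module _ (n : ℕ) where

    private
      open MembershipDec {A = Fin n} Fin._≟_ using (_∈?_)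

      injections : ∀ k → List (Vec (Fin n) k)
      injections k = filter unique? (allVecs n k)

      Fresh : Fin n → Vec (Fin n) k → Set
      Fresh i v = Unique (toList v) × i ∉ toList v

      fresh? : ∀ i (v : Vec (Fin n) k) → Dec (Fresh i v)
      fresh? i v = unique? v ×-dec ¬? (i ∈? toList v)

      count-∈ : ∀ (v : Vec (Fin n) k) → Unique (toList v) → count (_∈? toList v) (allFin n) ≡ k
      count-∈ {k} v u = ≤-antisym
        (subst (count (_∈? toList v) (allFin n) ≤_) (length-toList v)
          (Unique-⊆⇒length-≤ (Unique.filter⁺ (_∈? toList v) (Unique.allFin⁺ n))
                              (proj₂ ∘ ∈-filter⁻ (_∈? toList v) {xs = allFin n})))
        (subst (_≤ count (_∈? toList v) (allFin n)) (length-toList v)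
          (Unique-⊆⇒length-≤ u (λ {x} → ∈-filter⁺ (_∈? toList v) (∈-allFin x))))

      count-fresh : ∀ (v : Vec (Fin n) k) → Unique (toList v) → count (λ i → fresh? i v) (allFin n) ≡ n ∸ k
      count-fresh {k} v u = begin
        count (λ i → fresh? i v) (allFin n)
          ≡⟨ count-≐ (λ i → fresh? i v) (λ i → ¬? (i ∈? toList v)) (proj₂ , (u ,_)) (allFin n) ⟩
        count (λ i → ¬? (i ∈? toList v)) (allFin n)
          ≡⟨ m+n∸m≡n (count (_∈? toList v) (allFin n)) _ ⟨
        count (_∈? toList v) (allFin n) + count (λ i → ¬? (i ∈? toList v)) (allFin n) ∸ count (_∈? toList v) (allFin n)
          ≡⟨ cong₂ _∸_ (count-+-count-¬ (_∈? toList v) (allFin n)) (count-∈ v u) ⟩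
        length (allFin n) ∸ k
          ≡⟨ cong (_∸ k) (length-tabulate {n = n} (λ i → i)) ⟩
        n ∸ k ∎
        where open ≡-Reasoning

      Unique-∷≐Fresh : ∀ i → (λ (v : Vec (Fin n) k) → Unique (toList (i ∷ v))) ≐ Fresh i
      Unique-∷≐Fresh i = (λ { (i∉ ∷ u) → u , All¬⇒¬Any i∉ }) , λ {v} (u , i∉) → ¬Any⇒All¬ (toList v) i∉ ∷ u

      length-injections-suc : ∀ k → length (injections (suc k)) ≡ (n ∸ k) * length (injections k)
      length-injections-suc k = begin
        count unique? (allVecs n (suc k))
          ≡⟨ count-concatMap unique? (λ i → map (i ∷_) (allVecs n k)) (allFin n) ⟩
        sum (map (λ i → count unique? (map (i ∷_) (allVecs n k))) (allFin n))
          ≡⟨ cong sum (map-cong (λ i → trans (count-map unique? (i ∷_) (allVecs n k))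
               (count-≐ (unique? ∘ (i ∷_)) (fresh? i) (Unique-∷≐Fresh i) (allVecs n k))) (allFin n)) ⟩
        sum (map (λ i → count (fresh? i) (allVecs n k)) (allFin n))
          ≡⟨ sum-count-swap fresh? (allFin n) (allVecs n k) ⟩
        sum (map (λ v → count (λ i → fresh? i v) (allFin n)) (allVecs n k))
          ≡⟨ sum-count-const unique? _ (n ∸ k)
               (λ v → count-fresh v ,
                      λ ¬u → count-none (λ i → fresh? i v) {xs = allFin n} (All.tabulate λ _ → ¬u ∘ proj₁))
               (allVecs n k) ⟩
        (n ∸ k) * length (injections k) ∎
        where open ≡-Reasoning

      length-injections : ∀ k → k ≤ n → (n ∸ k) ! * length (injections k) ≡ n !
      length-injections zero    _   = *-identityʳ (n !)
      length-injections (suc k) k<n = begin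
        (n ∸ suc k) ! * length (injections (suc k)) ≡⟨ cong ((n ∸ suc k) ! *_) (length-injections-suc k) ⟩
        (n ∸ suc k) ! * ((n ∸ k) * L)               ≡⟨ x*[y*z]≡y*x*z ((n ∸ suc k) !) (n ∸ k) L ⟩
        (n ∸ k) * (n ∸ suc k) ! * L                 ≡⟨ cong (λ t → t * (n ∸ suc k) ! * L) n∸k≡ ⟨
        suc (n ∸ suc k) ! * L                       ≡⟨ cong (λ t → t ! * L) n∸k≡ ⟩
        (n ∸ k) ! * L                               ≡⟨ length-injections k (<⇒≤ k<n) ⟩
        n !                                         ∎
        where
        open ≡-Reasoning
        L = length (injections k)
        n∸k≡ : suc (n ∸ suc k) ≡ n ∸ k
        n∸k≡ = sym (+-∸-assoc 1 k<n)
        x*[y*z]≡y*x*z : ∀ x y z → x * (y * z) ≡ y * x * z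
        x*[y*z]≡y*x*z x y z = trans (sym (*-assoc x y z)) (cong (_* z) (*-comm x y))

    length-Sn : length (Sn n) ≡ n !
    length-Sn = trans (sym (+-identityʳ _)) (trans (cong (λ t → t ! * length (injections n)) (sym (n∸n≡0 n)))
                                                     (length-injections n ≤-refl))

module FullOrbits where

  open Lists
  open Rotations
  open OrbitSizes
  open Permutations
  open import Data.Nat.Base
  open import Data.Nat.Properties
  open import Data.Fin.Base using (zero)
  open import Data.Vec.Base using (lookup)
  open import Data.List.Base using (List; filter; length; deduplicate; upTo; cartesianProduct)
  open import Data.List.Properties using (length-upTo)
  open import Data.List.Relation.Unary.All as All using (All)
  open import Data.List.Relation.Unary.Any as Any using (Any)
  import Data.List.Relation.Unary.AllPairs as AllPairs
  open import Data.List.Relation.Unary.Unique.Propositional using (Unique)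
  import Data.List.Relation.Unary.Unique.Propositional.Properties as Unique
  open import Data.List.Membership.Propositional using (_∈_; lose; find)
  open import Data.List.Membership.Propositional.Properties
    using (∈-upTo⁺; ∈-upTo⁻; ∈-filter⁻; ∈-deduplicate⁻; ∈-cartesianProduct⁺; ∈-cartesianProduct⁻)
  open import Data.Empty using (⊥-elim)
  open import Data.Product using (_×_; _,_; proj₁; proj₂)
  open import Relation.Binary.Definitions using (tri<; tri≈; tri>)
  open import Relation.Nullary using (¬_; Dec; ¬?)
  open import Function using (_∘_)
  open import Relation.Binary.PropositionalEquality

  module _ {m : ℕ} where

    private
      n : ℕ
      n = suc m

    Twist-shift⇒Equivariant : ∀ {y a b a′ b′ π} → Twist y a b π → Twist y a′ b′ π → b ≤ b′ →
      Equivariant y (b′ ∸ b) (rot⁻ {m} a′ + a)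
    Twist-shift⇒Equivariant {y} {a} {b} {a′} {b′} {π} t t′ b≤b′ z = begin
      lookup y (rot (b′ ∸ b) z)                       ≡⟨ cong (lookup y) (rot-∸ z b≤b′) ⟩
      lookup y (rot b′ i)                             ≡⟨ rot-inverseˡ a′ _ ⟨
      rot (rot⁻ a′) (rot a′ (lookup y (rot b′ i)))    ≡⟨ cong (rot (rot⁻ a′)) (at t′ i) ⟨
      rot (rot⁻ a′) (lookup π i)                      ≡⟨ cong (rot (rot⁻ a′)) (at t i) ⟩
      rot (rot⁻ a′) (rot a (lookup y (rot b i)))      ≡⟨ rot-+ (rot⁻ a′) a _ ⟩
      rot (rot⁻ a′ + a) (lookup y (rot b i))          ≡⟨ cong (rot (rot⁻ a′ + a) ∘ lookup y) (rot-inverseʳ b z) ⟩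
      rot (rot⁻ a′ + a) (lookup y z)                  ∎
      where
      open ≡-Reasoning
      i = rot (rot⁻ b) z

    Twist-shift⇒orbitSize<n : ∀ {y a b a′ b′ π} → Twist y a b π → Twist y a′ b′ π →
                              b < b′ → b′ < n → orbitSize y < n
    Twist-shift⇒orbitSize<n {y} {a} {b} {a′} {b′} t t′ b<b′ b′<n = ≤-<-trans
      (orbitSize≤period y (b′ ∸ b) (rot⁻ {m} a′ + a) {{>-nonZero (m<n⇒0<n∸m b<b′)}}
                        (Twist-shift⇒Equivariant t t′ (<⇒≤ b<b′)))
      (≤-<-trans (m∸n≤m b′ b) b′<n)

    Twist-injective : ∀ {y a b a′ b′ π} → orbitSize y ≡ n → a < n → b < n → a′ < n → b′ < n →
      Twist y a b π → Twist y a′ b′ π → (a , b) ≡ (a′ , b′)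
    Twist-injective {y} {a} {b} {a′} {b′} full a<n b<n a′<n b′<n t t′ with <-cmp b b′
    ... | tri< b<b′ _ _ = ⊥-elim (<-irrefl full (Twist-shift⇒orbitSize<n t t′ b<b′ b′<n))
    ... | tri> _ _ b′<b = ⊥-elim (<-irrefl full (Twist-shift⇒orbitSize<n t′ t b′<b b<n))
    ... | tri≈ _ refl _ =
      cong (_, b) (rot-injectiveˡ (lookup y (rot b zero)) a<n a′<n (trans (sym (at t zero)) (at t′ zero)))

    full? : ∀ (π : Vecn n) → Dec (orbitSize π ≡ n)
    full? π = orbitSize π ≟ n

    fullPerms : List (Vecn n)
    fullPerms = filter full? (Sn n)

    -- one representative per f-orbit consisting of n classes; its length is cycles1 n n
    fullOrbitReps : List (Vecn n)
    fullOrbitReps = deduplicate SameOrbit? fullPerms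

    nonFull : ℕ
    nonFull = count (¬? ∘ full?) (Sn n)

    length-fullPerms+nonFull : length fullPerms + nonFull ≡ n !
    length-fullPerms+nonFull = trans (count-+-count-¬ full? (Sn n)) (length-Sn n)

    private
      shifts : List (ℕ × ℕ)
      shifts = cartesianProduct (upTo n) (upTo n)

      length-shifts : length shifts ≡ n * n
      length-shifts = trans (length-cartesianProductWith _,_ (upTo n) (upTo n)) (cong₂ _*_ (length-upTo n) (length-upTo n))

      twistBy : Vecn n × (ℕ × ℕ) → Vecn n
      twistBy (y , a , b) = twist y a b

      twists : List (Vecn n × (ℕ × ℕ))
      twists = cartesianProduct fullOrbitReps shifts

      length-twists : length twists ≡ length fullOrbitReps * (n * n)
      length-twists = trans (length-cartesianProductWith _,_ fullOrbitReps shifts) (cong (length fullOrbitReps *_) length-shifts)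

      rep-full : ∀ {y} → y ∈ fullOrbitReps → orbitSize y ≡ n
      rep-full y∈ = proj₂ (∈-filter⁻ full? {xs = Sn n} (∈-deduplicate⁻ SameOrbit? fullPerms y∈))

      reps-apart : AllPairs.AllPairs (λ y y′ → ¬ SameOrbit y y′) fullOrbitReps
      reps-apart = deduplicate-apart SameOrbit? fullPerms

      twist≡⇒Twist : ∀ {x} (y′ : Vecn n) a′ b′ → x ≡ twist y′ a′ b′ → Twist y′ a′ b′ x
      twist≡⇒Twist y′ a′ b′ eq = subst (Twist y′ a′ b′) (sym eq) (twist-Twist y′ a′ b′)

      twist≡⇒SameOrbit : ∀ (y : Vecn n) a b y′ a′ b′ → twist y a b ≡ twist y′ a′ b′ → SameOrbit y y′
      twist≡⇒SameOrbit y a b y′ a′ b′ eq =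
        Twist⇒SameOrbit (Twist-trans (twist-Twist y a b) (Twist-sym (twist≡⇒Twist y′ a′ b′ eq)))

    length-fullPerms≤ : length fullPerms ≤ length fullOrbitReps * (n * n)
    length-fullPerms≤ = subst (length fullPerms ≤_) length-twists
      (length-≤-cover fullPerms twists (Unique.filter⁺ full? (Sn-unique n)) (All.tabulate covered)
        (λ { refl refl x≢x → x≢x refl }))
      where
      covered : ∀ {x} → x ∈ fullPerms → Any (λ t → x ≡ twistBy t) twists
      covered x∈ =
        let y , y∈ , y~x = find (deduplicate-represents SameOrbit?
                                   (λ {π} → SameOrbit-refl π) (λ {π π′ π″} → SameOrbit-trans π π′ π″) x∈)
            a , b , a<n , b<n , t = SameOrbit⇒Twist {π = y} y~x
        in lose (∈-cartesianProduct⁺ y∈ (∈-cartesianProduct⁺ (∈-upTo⁺ a<n) (∈-upTo⁺ b<n))) (Twist⇒≡twist t)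

    length-fullOrbitReps≤ : length fullOrbitReps * (n * n) ≤ n !
    length-fullOrbitReps≤ = subst₂ _≤_ length-twists (length-Sn n)
      (length-≤-cover twists (Sn n)
        (AllPairs-restrict distinct (All.tabulate (λ t∈ → t∈))
          (Unique.cartesianProduct⁺ reps-unique (Unique.cartesianProduct⁺ (Unique.upTo⁺ n) (Unique.upTo⁺ n))))
        (All.tabulate λ t∈ → Any.map sym (twist-∈-Sn t∈))
        (λ x≡ x≡′ ≢ → ≢ (trans (sym x≡) x≡′)))
      where
      reps-unique : Unique fullOrbitReps
      reps-unique = AllPairs.map (λ {y} ¬y~y′ y≡y′ → ¬y~y′ (subst (SameOrbit y) y≡y′ (SameOrbit-refl y))) reps-apart

      twist-∈-Sn : ∀ {t} → t ∈ twists → twistBy t ∈ Sn n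
      twist-∈-Sn {y , a , b} t∈ = ∈-Sn⁺ (twist y a b) λ {i} {j} eq →
        rot-injective b (∈-Sn⁻ y∈Sn (rot-injective a
          (trans (sym (at (twist-Twist y a b) i)) (trans eq (at (twist-Twist y a b) j)))))
        where
        y∈Sn : y ∈ Sn n
        y∈Sn = proj₁ (∈-filter⁻ full? {xs = Sn n}
                 (∈-deduplicate⁻ SameOrbit? fullPerms (proj₁ (∈-cartesianProduct⁻ fullOrbitReps shifts t∈))))

      distinct : ∀ {t t′} → t ∈ twists → t′ ∈ twists → t ≢ t′ → twistBy t ≢ twistBy t′
      distinct {y , a , b} {y′ , a′ , b′} t∈ t′∈ t≢t′ eq =
        let y∈ , ab∈   = ∈-cartesianProduct⁻ fullOrbitReps shifts t∈
            y′∈ , a′b′∈ = ∈-cartesianProduct⁻ fullOrbitReps shifts t′∈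
            a∈ , b∈    = ∈-cartesianProduct⁻ (upTo n) (upTo n) ab∈
            a′∈ , b′∈  = ∈-cartesianProduct⁻ (upTo n) (upTo n) a′b′∈
            y≡y′ = AllPairs-∈-≡ reps-apart y∈ y′∈ (λ ¬y~y′ → ¬y~y′ (twist≡⇒SameOrbit y a b y′ a′ b′ eq))
                                                 (λ ¬y′~y → ¬y′~y (twist≡⇒SameOrbit y′ a′ b′ y a b (sym eq)))
            ab≡a′b′ = Twist-injective (rep-full y∈) (∈-upTo⁻ a∈) (∈-upTo⁻ b∈) (∈-upTo⁻ a′∈) (∈-upTo⁻ b′∈)
                        (twist-Twist y a b)
                        (subst (λ z → Twist z a′ b′ (twist y a b)) (sym y≡y′) (twist≡⇒Twist y′ a′ b′ eq))
        in t≢t′ (cong₂ _,_ y≡y′ ab≡a′b′)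

module SymmetricPermutations where

  open Lists
  open Rotations
  open OrbitSizes
  open Permutations
  open FullOrbits
  open Growth using (n≤[n/2]*2+1)
  open import Data.Nat.Base
  open import Data.Nat.Properties
  open import Data.Nat.DivMod
  open import Data.Fin.Base using (Fin; toℕ; fromℕ<; inject≤)
  open import Data.Fin.Properties using (toℕ<n; toℕ-injective; toℕ-inject≤; toℕ-fromℕ<)
  open import Data.Vec.Base using (Vec; lookup; tabulate)
  open import Data.Vec.Properties using (lookup∘tabulate; tabulate∘lookup; tabulate-cong)
  open import Data.List.Base using (List; filter; length; upTo; cartesianProduct)
  open import Data.List.Properties using (length-upTo)
  open import Data.List.Relation.Unary.All as All using (All)
  open import Data.List.Relation.Unary.Any using (Any)
  import Data.List.Relation.Unary.Unique.Propositional.Properties as Unique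
  open import Data.List.Membership.Propositional using (_∈_; lose)
  open import Data.List.Membership.Propositional.Properties using (∈-upTo⁺; ∈-filter⁻; ∈-cartesianProduct⁺)
  open import Data.Empty using (⊥)
  open import Data.Product using (_×_; _,_; proj₂)
  open import Function using (_∘_)
  open import Relation.Nullary using (yes; no; ¬?)
  open import Relation.Binary.PropositionalEquality

  module _ {m : ℕ} where

    private
      n : ℕ
      n = suc m

    -- An equivariant permutation is determined by its symmetry and its values on [0, h) when n ≤ 2h + 1:
    -- every other point is reached from a smaller one by a forward step of c (if c ≤ h) or a
    -- wrapping step of c (if c > h).
    Equivariant-≡ : ∀ {h c j} (π π′ : Vecn n) → n ≤ h + h + 1 → 0 < c → c < n →
      Equivariant π c j → Equivariant π′ c j → (∀ i → toℕ i < h → lookup π i ≡ lookup π′ i) → π ≡ π′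
    Equivariant-≡ {h} {c} {j} π π′ n≤2h+1 0<c c<n eq eq′ agree-below =
      trans (sym (tabulate∘lookup π)) (trans (tabulate-cong (λ i → agree n i (toℕ<n i))) (tabulate∘lookup π′))
      where
      open ≡-Reasoning
      wraps-down : ∀ {k} i → k < n → n ≤ toℕ i + k → toℕ (rot k i) < toℕ i
      wraps-down {k} i k<n n≤i+k = subst (_< toℕ i) (sym (toℕ-rot-wrap i (<⇒≤ k<n) n≤i+k))
        (+-cancelʳ-< n _ (toℕ i) (subst (_< toℕ i + n) (sym (m∸n+n≡m n≤i+k)) (+-monoʳ-< (toℕ i) k<n)))

      agree : ∀ K i → toℕ i < K → lookup π i ≡ lookup π′ i
      agree (suc K) i i<1+K with toℕ i <? h | c ≤? h
      ... | yes i<h | _ = agree-below i i<h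
      ... | no i≮h | yes c≤h = begin
        lookup π i               ≡⟨ cong (lookup π) back ⟨
        lookup π (rot c i′)      ≡⟨ eq i′ ⟩
        rot j (lookup π i′)      ≡⟨ cong (rot j) (agree K i′ (≤-trans (wraps-down i n∸c<n n≤i+n∸c) (s≤s⁻¹ i<1+K))) ⟩
        rot j (lookup π′ i′)     ≡⟨ eq′ i′ ⟨
        lookup π′ (rot c i′)     ≡⟨ cong (lookup π′) back ⟩
        lookup π′ i              ∎
        where
        i′ = rot (n ∸ c) i
        back : rot c i′ ≡ i
        back = trans (rot-+ c (n ∸ c) i) (trans (cong (λ k → rot k i) (m+[n∸m]≡n (<⇒≤ c<n))) (rot-n i))
        n∸c<n : n ∸ c < n
        n∸c<n = ∸-monoʳ-< 0<c (<⇒≤ c<n)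
        n≤i+n∸c : n ≤ toℕ i + (n ∸ c)
        n≤i+n∸c = subst (_≤ toℕ i + (n ∸ c)) (m+[n∸m]≡n (<⇒≤ c<n))
                        (+-monoˡ-≤ (n ∸ c) (≤-trans c≤h (≮⇒≥ i≮h)))
      ... | no i≮h | no c≰h = rot-injective j (begin
        rot j (lookup π i)       ≡⟨ eq i ⟨
        lookup π (rot c i)       ≡⟨ agree K (rot c i) (≤-trans (wraps-down i c<n n≤i+c) (s≤s⁻¹ i<1+K)) ⟩
        lookup π′ (rot c i)      ≡⟨ eq′ i ⟩
        rot j (lookup π′ i)      ∎)
        where
        n≤i+c : n ≤ toℕ i + c
        n≤i+c = ≤-trans n≤2h+1 (subst (_≤ toℕ i + c) (sym (+-assoc h h 1))
                  (+-mono-≤ (≮⇒≥ i≮h) (subst (_≤ c) (+-comm 1 h) (≰⇒> c≰h))))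

    private
      h : ℕ
      h = n / 2

      h≤n : h ≤ n
      h≤n = m/n≤m n 2

      prefix : Vecn n → Vec (Fin n) h
      prefix π = tabulate (λ t → lookup π (inject≤ t h≤n))

      Code : Set
      Code = ℕ × ℕ × Vec (Fin n) h

      codes : List Code
      codes = cartesianProduct (upTo n) (cartesianProduct (upTo n) (allVecs n h))

      length-codes : length codes ≡ n * (n * n ^ h)
      length-codes = trans (length-cartesianProductWith _,_ (upTo n) (cartesianProduct (upTo n) (allVecs n h)))
        (cong₂ _*_ (length-upTo n) (trans (length-cartesianProductWith _,_ (upTo n) (allVecs n h))
                                          (cong₂ _*_ (length-upTo n) (length-allVecs n h))))

      Encodes : Code → Vecn n → Set
      Encodes (c , j , v) π = 0 < c × c < n × Equivariant π c j × prefix π ≡ v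

    nonFull≤ : nonFull {m} ≤ n * (n * n ^ (n / 2))
    nonFull≤ = subst (nonFull {m} ≤_) length-codes
      (length-≤-cover (filter (¬? ∘ full?) (Sn n)) codes (Unique.filter⁺ (¬? ∘ full?) (Sn-unique n))
        (All.tabulate covered) (λ {t} → decoded {t}))
      where
      covered : ∀ {π} → π ∈ filter (¬? ∘ full?) (Sn n) → Any (λ t → Encodes t π) codes
      covered {π} π∈ =
        let c , c<n , 0<c , j , j<n , eq = orbitSize≢n⇒Symmetric π (proj₂ (∈-filter⁻ (¬? ∘ full?) {xs = Sn n} π∈))
        in lose (∈-cartesianProduct⁺ (∈-upTo⁺ c<n) (∈-cartesianProduct⁺ (∈-upTo⁺ j<n) (∈-allVecs n (prefix π))))
                (0<c , c<n , eq , refl)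
      decoded : ∀ {t π π′} → Encodes t π → Encodes t π′ → π ≢ π′ → ⊥
      decoded {c , j , v} {π} {π′} (0<c , c<n , eq , refl) (_ , _ , eq′ , same) π≢π′ =
        π≢π′ (Equivariant-≡ {h} {c} {j} π π′ (n≤[n/2]*2+1 n) 0<c c<n eq eq′ agree-below)
        where
        agree-below : ∀ i → toℕ i < h → lookup π i ≡ lookup π′ i
        agree-below i i<h = begin
          lookup π i                    ≡⟨ cong (lookup π) i≡ ⟨
          lookup π (inject≤ t h≤n)      ≡⟨ lookup∘tabulate _ t ⟨
          lookup (prefix π) t           ≡⟨ cong (λ v → lookup v t) same ⟨
          lookup (prefix π′) t          ≡⟨ lookup∘tabulate _ t ⟩
          lookup π′ (inject≤ t h≤n)     ≡⟨ cong (lookup π′) i≡ ⟩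
          lookup π′ i                   ∎
          where
          open ≡-Reasoning
          t = fromℕ< i<h
          i≡ : inject≤ t h≤n ≡ i
          i≡ = toℕ-injective (trans (toℕ-inject≤ t h≤n) (toℕ-fromℕ< i<h))

module DivisorSum where

  open Lists
  open FullOrbits
  open import Data.Nat.Base
  open import Data.Nat.Properties
  open import Data.Nat.Divisibility using (_∣?_; ∣-refl)
  open import Data.List.Base using ([]; _∷_; map; filter; upTo)
  open import Data.List.Properties using (length-deduplicate)
  open import Data.List.Relation.Unary.All as All using (All)
  open import Data.List.Relation.Unary.Any using (here)
  open import Data.List.Relation.Unary.Unique.Propositional using (Unique)
  import Data.List.Relation.Unary.Unique.Propositional.Properties as Unique
  open import Data.List.Membership.Propositional using (_∈_)
  open import Data.List.Membership.Propositional.Properties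
    using (∈-filter⁺; ∈-filter⁻; ∈-map⁺; ∈-map⁻; ∈-upTo⁺; ∈-upTo⁻)
  open import Data.Nat.ListAction using (sum)
  open import Data.Product using (_×_; _,_; proj₁; proj₂)
  open import Function using (_∘_)
  open import Relation.Nullary using (Dec; yes; no; ¬?)
  open import Relation.Nullary.Decidable using (_×-dec_)
  open import Relation.Binary.PropositionalEquality

  divisors-unique : ∀ n → Unique (divisors n)
  divisors-unique n = Unique.filter⁺ (_∣? n) (Unique.map⁺ suc-injective (Unique.upTo⁺ n))

  ∈-divisors : ∀ m → suc m ∈ divisors (suc m)
  ∈-divisors m = ∈-filter⁺ (_∣? suc m) (∈-map⁺ suc (∈-upTo⁺ ≤-refl)) ∣-refl

  ∈-divisors⇒≤ : ∀ {n d} → d ∈ divisors n → d ≤ n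
  ∈-divisors⇒≤ {n} d∈ with k , k∈ , refl ← ∈-map⁻ suc (proj₁ (∈-filter⁻ (_∣? n) {xs = map suc (upTo n)} d∈)) =
    ∈-upTo⁻ k∈

  module _ {m : ℕ} where

    private
      n : ℕ
      n = suc m

    weight : ℕ → ℕ
    weight d = cycles1 n d * (d + n ∸ 2)

    weight-n≤ : weight n ≤ sum (map weight (divisors n))
    weight-n≤ = sum-map-∈ weight (∈-divisors m)

    private
      SmallOrbit : ℕ → Vecn n → Set
      SmallOrbit d π = orbitSize π ≡ d × d ≢ n

      smallOrbit? : ∀ d π → Dec (SmallOrbit d π)
      smallOrbit? d π = (orbitSize π ≟ d) ×-dec ¬? (d ≟ n)

      weight≤ : ∀ {d} → d ∈ divisors n → d ≢ n → weight d ≤ (n + n) * count (smallOrbit? d) (Sn n)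
      weight≤ {d} d∈ d≢n = begin
        cycles1 n d * (d + n ∸ 2)
          ≤⟨ *-mono-≤ cycles≤ (≤-trans (m∸n≤m (d + n) 2) (+-monoˡ-≤ n (∈-divisors⇒≤ d∈))) ⟩
        count (smallOrbit? d) (Sn n) * (n + n)
          ≡⟨ *-comm _ (n + n) ⟩
        (n + n) * count (smallOrbit? d) (Sn n) ∎
        where
        open ≤-Reasoning
        cycles≤ : cycles1 n d ≤ count (smallOrbit? d) (Sn n)
        cycles≤ = ≤-trans (length-deduplicate SameOrbit? (filter (λ π → orbitSize π ≟ d) (Sn n)))
          (≤-reflexive (count-≐ (λ π → orbitSize π ≟ d) (smallOrbit? d) ((_, d≢n) , proj₁) (Sn n)))

      smallOrbits-of : ∀ π → count (λ d → smallOrbit? d π) (divisors n) ≤ count (¬? ∘ full?) (π ∷ [])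
      smallOrbits-of π with full? π
      ... | yes full = ≤-trans (≤-reflexive (count-none (λ d → smallOrbit? d π) {xs = divisors n}
                         (All.tabulate λ _ (size≡d , d≢n) → d≢n (trans (sym size≡d) full)))) z≤n
      ... | no ¬full = begin
        count (λ d → smallOrbit? d π) (divisors n)
          ≤⟨ count-mono (λ d → smallOrbit? d π) (_≟ orbitSize π) (sym ∘ proj₁) (divisors n) ⟩
        count (_≟ orbitSize π) (divisors n)
          ≤⟨ Unique-⊆⇒length-≤ {ys = orbitSize π ∷ []} (Unique.filter⁺ (_≟ orbitSize π) (divisors-unique n))
                                (here ∘ proj₂ ∘ ∈-filter⁻ (_≟ orbitSize π) {xs = divisors n}) ⟩
        1
          ≡⟨ count-singleton (¬? ∘ full?) ¬full ⟨
        count (¬? ∘ full?) (π ∷ [])                  ∎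
        where open ≤-Reasoning

    sum-weight≤ : sum (map weight (divisors n)) ≤ weight n + (n + n) * nonFull {m}
    sum-weight≤ = begin
      sum (map weight (divisors n))
        ≤⟨ sum-map-≤-except n (divisors-unique n) (All.tabulate weight≤) ⟩
      weight n + sum (map (λ d → (n + n) * count (smallOrbit? d) (Sn n)) (divisors n))
        ≡⟨ cong (weight n +_) (sum-map-* (n + n) (λ d → count (smallOrbit? d) (Sn n)) (divisors n)) ⟩
      weight n + (n + n) * sum (map (λ d → count (smallOrbit? d) (Sn n)) (divisors n))
        ≡⟨ cong (λ t → weight n + (n + n) * t) (sum-count-swap smallOrbit? (divisors n) (Sn n)) ⟩
      weight n + (n + n) * sum (map (λ π → count (λ d → smallOrbit? d π) (divisors n)) (Sn n))
        ≤⟨ +-monoʳ-≤ (weight n) (*-monoʳ-≤ (n + n)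
             (sum-map-mono {f = λ π → count (λ d → smallOrbit? d π) (divisors n)} {xs = Sn n}
                           (All.tabulate λ {π} _ → smallOrbits-of π))) ⟩
      weight n + (n + n) * sum (map (λ π → count (¬? ∘ full?) (π ∷ [])) (Sn n))
        ≡⟨ cong (λ t → weight n + (n + n) * t) (sum-count-singletons (¬? ∘ full? {m}) (Sn n)) ⟩
      weight n + (n + n) * nonFull {m} ∎
      where open ≤-Reasoning

module Distance where

  open import Data.Nat.Base
  open import Data.Nat.Properties
  open import Data.Nat.Tactic.RingSolver using (solve-∀)
  open import Data.Integer.Base as ℤ using (_⊖_)
  import Data.Integer.Properties as ℤ
  open import Relation.Binary.PropositionalEquality
  open import Relation.Nullary using (yes; no)

  ∣⊖∣*≤ : ∀ x y n d → x * n ≤ y * n + d → y * n ≤ x * n + d → ℤ.∣ x ⊖ y ∣ * n ≤ d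
  ∣⊖∣*≤ x y n d xn≤ yn≤ with x ≤? y
  ... | yes x≤y = begin
    ℤ.∣ x ⊖ y ∣ * n   ≡⟨ cong (_* n) (ℤ.∣⊖∣-≤ x≤y) ⟩
    (y ∸ x) * n       ≡⟨ *-distribʳ-∸ n y x ⟩
    y * n ∸ x * n     ≤⟨ m≤n+o⇒m∸n≤o (y * n) (x * n) yn≤ ⟩
    d                 ∎
    where open ≤-Reasoning
  ... | no x≰y = begin
    ℤ.∣ x ⊖ y ∣ * n   ≡⟨ cong (_* n) (trans (ℤ.∣m⊖n∣≡∣n⊖m∣ x y) (ℤ.∣⊖∣-≤ (≰⇒≥ x≰y))) ⟩
    (x ∸ y) * n       ≡⟨ *-distribʳ-∸ n x y ⟩
    x * n ∸ y * n     ≤⟨ m≤n+o⇒m∸n≤o (x * n) (y * n) xn≤ ⟩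
    d                 ∎
    where open ≤-Reasoning

  -- The bookkeeping behind B(n) ≈ 2 (n-1)!: with G = (n-1)!, the a permutations with a full
  -- orbit fill c orbits of n² permutations each, the s others are negligible, and
  -- c (2n - 2) ≤ T ≤ c (2n - 2) + 2n s.
  distance-bound : ∀ k (c a s T G : ℕ) → let n = suc k in
    a + s ≡ n * G → a ≤ c * (n * n) → c * (n * n) ≤ n * G → 2 * (n * n) * s ≤ G → n ≤ G →
    c * (n + n ∸ 2) ≤ T → T ≤ c * (n + n ∸ 2) + (n + n) * s →
    ℤ.∣ (1 + T) ⊖ 2 * G ∣ * n ≤ 4 * G
  distance-bound k c a s T G a+s≡nG a≤cn² cn²≤nG 2n²s≤G n≤G ce≤T T≤ce+2ns =
    ∣⊖∣*≤ (1 + T) (2 * G) n (4 * G) upper lower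
    where
    open ≤-Reasoning
    n = suc k
    e = n + n ∸ 2

    e+2≡2n : e + 2 ≡ n + n
    e+2≡2n = m∸n+n≡m (s≤s (≤-trans (s≤s z≤n) (m≤n+m (suc k) k)))

    cn≤G : c * n ≤ G
    cn≤G = *-cancelˡ-≤ n (subst (_≤ n * G) (x*[y*y]≡y*[x*y] c n) cn²≤nG)
      where
      x*[y*y]≡y*[x*y] : ∀ x y → x * (y * y) ≡ y * (x * y)
      x*[y*y]≡y*[x*y] = solve-∀

    2s≤G : 2 * s ≤ G
    2s≤G = ≤-trans (*-monoˡ-≤ s (*-monoʳ-≤ 2 (s≤s (z≤n {k + k * n})))) 2n²s≤G

    upper : (1 + T) * n ≤ 2 * G * n + 4 * G
    upper = begin
      (1 + T) * n                        ≡⟨ *-distribʳ-+ n 1 T ⟩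
      1 * n + T * n                      ≤⟨ +-mono-≤ (≤-reflexive (*-identityˡ n)) (*-monoˡ-≤ n T≤ce+2ns) ⟩
      n + (c * e + (n + n) * s) * n      ≡⟨ cong (n +_) (expand c e n s) ⟩
      n + (c * n * e + 2 * (n * n) * s)  ≤⟨ +-mono-≤ n≤G (+-mono-≤ (*-mono-≤ cn≤G (m∸n≤m (n + n) 2)) 2n²s≤G) ⟩
      G + (G * (n + n) + G)              ≡⟨ collect G n ⟩
      2 * G * n + 2 * G                  ≤⟨ +-monoʳ-≤ (2 * G * n) (*-monoˡ-≤ G (s≤s (s≤s (z≤n {2})))) ⟩
      2 * G * n + 4 * G                  ∎
      where
      expand : ∀ c e n s → (c * e + (n + n) * s) * n ≡ c * n * e + 2 * (n * n) * s
      expand = solve-∀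
      collect : ∀ G n → G + (G * (n + n) + G) ≡ 2 * G * n + 2 * G
      collect = solve-∀

    lower : 2 * G * n ≤ (1 + T) * n + 4 * G
    lower = begin
      2 * G * n                          ≡⟨ *-assoc 2 G n ⟩
      2 * (G * n)                        ≡⟨ cong (2 *_) (trans (*-comm G n) (sym a+s≡nG)) ⟩
      2 * (a + s)                        ≤⟨ *-monoʳ-≤ 2 (+-monoˡ-≤ s a≤cn²) ⟩
      2 * (c * (n * n) + s)              ≡⟨ split c n s ⟩
      c * n * (n + n) + 2 * s            ≡⟨ cong (λ t → c * n * t + 2 * s) e+2≡2n ⟨
      c * n * (e + 2) + 2 * s            ≡⟨ regroup c n e s ⟩
      c * e * n + (2 * (c * n) + 2 * s)  ≤⟨ +-mono-≤ (*-monoˡ-≤ n ce≤T) (+-mono-≤ (*-monoʳ-≤ 2 cn≤G) 2s≤G) ⟩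
      T * n + (2 * G + G)                ≤⟨ +-mono-≤ (m≤n+m (T * n) n) (+-monoʳ-≤ (2 * G) (m≤m+n G G)) ⟩
      n + T * n + (2 * G + (G + G))      ≡⟨ collect n T G ⟩
      (1 + T) * n + 4 * G                ∎
      where
      split : ∀ c n s → 2 * (c * (n * n) + s) ≡ c * n * (n + n) + 2 * s
      split = solve-∀
      regroup : ∀ c n e s → c * n * (e + 2) + 2 * s ≡ c * e * n + (2 * (c * n) + 2 * s)
      regroup = solve-∀
      collect : ∀ n T G → n + T * n + (2 * G + (G + G)) ≡ (1 + T) * n + 4 * G
      collect = solve-∀

  cross-multiply : ∀ d n g q p .{{_ : NonZero g}} → d * n ≤ 4 * g → 4 * q < n → d * q < suc p * g
  cross-multiply d n g q p dn≤4g 4q<n = *-cancelˡ-< n (d * q) (suc p * g) (begin-strict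
    n * (d * q)        ≡⟨ x*[y*z]≡y*x*z n d q ⟩
    d * n * q          ≤⟨ *-monoˡ-≤ q dn≤4g ⟩
    4 * g * q          ≡⟨ x*y*z≡y*[x*z] 4 g q ⟩
    g * (4 * q)        <⟨ *-monoʳ-< g 4q<n ⟩
    g * n              ≤⟨ *-monoˡ-≤ n (m≤n*m g (suc p)) ⟩
    suc p * g * n      ≡⟨ *-comm (suc p * g) n ⟩
    n * (suc p * g)    ∎)
    where
    open ≤-Reasoning
    x*[y*z]≡y*x*z : ∀ x y z → x * (y * z) ≡ y * x * z
    x*[y*z]≡y*x*z = solve-∀
    x*y*z≡y*[x*z] : ∀ x y z → x * y * z ≡ y * (x * z)
    x*y*z≡y*[x*z] = solve-∀

module RationalBound where

  open import Data.Nat.Base as ℕ using (suc; NonZero)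
  import Data.Nat.Properties as ℕ
  open import Data.Integer.Base as ℤ using (+_; +[1+_]; -[1+_]; _⊖_)
  import Data.Integer.Properties as ℤ
  open import Data.Rational.Base using (ℚ; mkℚ; _<_; _-_; ∣_∣; 0ℚ; 1ℚ; _+_; _/_; ↧ₙ_; toℚᵘ; -_; positive)
  import Data.Rational.Properties as ℚ
  import Data.Rational.Unnormalised.Base as ℚᵘ
  import Data.Rational.Unnormalised.Properties as ℚᵘ
  open import Relation.Binary.PropositionalEquality
  open Distance using (cross-multiply)

  ∣b/g-2∣<ε : ∀ b g .{{_ : NonZero g}} (ε : ℚ) → 0ℚ < ε → ∀ n →
    ℤ.∣ b ⊖ 2 ℕ.* g ∣ ℕ.* n ℕ.≤ 4 ℕ.* g → 4 ℕ.* ↧ₙ ε ℕ.< n → ∣ (+ b) / g - (1ℚ + 1ℚ) ∣ < ε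
  ∣b/g-2∣<ε b (suc g′) (mkℚ +[1+ p ] q _) _ n dn≤4g 4q<n =
    ℚ.toℚᵘ-cancel-< (ℚᵘ.<-respˡ-≃ (ℚᵘ.≃-sym toℚᵘ-distance)
      (ℚᵘ.*<* (subst₂ ℤ._<_ lhs rhs (ℤ.+<+ (cross-multiply (ℤ.∣ b ⊖ 2 ℕ.* g ∣) n g (suc q) p dn≤4g 4q<n)))))
    where
    g = suc g′
    x = (+ b) / g
    x′ = ℚᵘ.mkℚᵘ (+ b) g′
    two = 1ℚ + 1ℚ

    toℚᵘ-distance : toℚᵘ ∣ x - two ∣ ℚᵘ.≃ ℚᵘ.∣ x′ ℚᵘ.- toℚᵘ two ∣
    toℚᵘ-distance = ℚᵘ.≃-trans (ℚ.toℚᵘ-homo-∣-∣ (x - two)) (ℚᵘ.∣-∣-cong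
      (ℚᵘ.≃-trans (ℚ.toℚᵘ-homo-+ x (- two)) (ℚᵘ.+-cong (ℚ.toℚᵘ-fromℚᵘ x′) (ℚ.toℚᵘ-homo‿- two))))

    numerator : + b ℤ.* + 1 ℤ.+ (ℤ.- (+ 2)) ℤ.* + g ≡ b ⊖ (2 ℕ.* g)
    numerator = trans (cong₂ ℤ._+_ (ℤ.*-identityʳ (+ b))
                                   (trans (sym (ℤ.neg-distribˡ-* (+ 2) (+ g))) (cong ℤ.-_ (sym (ℤ.pos-* 2 g)))))
                      (ℤ.m-n≡m⊖n b (2 ℕ.* g))

    lhs : + (ℤ.∣ b ⊖ 2 ℕ.* g ∣ ℕ.* suc q) ≡ + ℤ.∣ + b ℤ.* + 1 ℤ.+ (ℤ.- (+ 2)) ℤ.* + g ∣ ℤ.* + suc q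
    lhs = trans (ℤ.pos-* (ℤ.∣ b ⊖ 2 ℕ.* g ∣) (suc q)) (cong (λ t → + ℤ.∣ t ∣ ℤ.* + suc q) (sym numerator))

    rhs : + (suc p ℕ.* g) ≡ +[1+ p ] ℤ.* + (g ℕ.* 1)
    rhs = trans (ℤ.pos-* (suc p) g) (cong (λ t → +[1+ p ] ℤ.* + t) (sym (ℕ.*-identityʳ g)))
  ∣b/g-2∣<ε b g (mkℚ (+ 0) _ _)    0<ε _ _ _ with () ← positive 0<ε
  ∣b/g-2∣<ε b g (mkℚ -[1+ _ ] _ _) 0<ε _ _ _ with () ← positive 0<ε

module Asymptotics where

  open FullOrbits
  open SymmetricPermutations
  open DivisorSum
  open Growth
  open Distance
  open RationalBound
  open import Data.Nat.Base as ℕ using (ℕ; suc; _!)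
  import Data.Nat.Properties as ℕ
  open import Data.Nat.DivMod using (_/_; /-monoˡ-≤)
  open import Data.Integer.Base as ℤ using (_⊖_)
  open import Data.List.Base using (length; map)
  open import Data.Nat.ListAction using (sum)
  open import Data.Rational.Base using (ℚ; _<_; _-_; ∣_∣; 0ℚ; 1ℚ; _+_; ↧ₙ_)

  distance-from-2[n-1]! : ∀ m → 127 ℕ.≤ m → ℤ.∣ B (suc m) ⊖ 2 ℕ.* m ! ∣ ℕ.* suc m ℕ.≤ 4 ℕ.* m !
  distance-from-2[n-1]! m 127≤m =
    distance-bound m (length (fullOrbitReps {m})) (length (fullPerms {m})) (nonFull {m})
                     (sum (map (weight {m}) (divisors n))) (m !)
      (length-fullPerms+nonFull {m}) (length-fullPerms≤ {m}) (length-fullOrbitReps≤ {m}) 2n²s≤G n≤G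
      (weight-n≤ {m}) (sum-weight≤ {m})
    where
    n = suc m
    h = n / 2
    poly≤G : 2 ℕ.* (n ℕ.* n) ℕ.* (n ℕ.* (n ℕ.* n ℕ.^ h)) ℕ.≤ m !
    poly≤G = poly≤factorial h m (/-monoˡ-≤ 2 (ℕ.m≤n⇒m≤1+n (ℕ.≤-trans (ℕ.m≤n+m 126 1) 127≤m)))
                                ([n/2]*2≤n n) (n≤[n/2]*2+1 n)
    2n²s≤G : 2 ℕ.* (n ℕ.* n) ℕ.* nonFull {m} ℕ.≤ m !
    2n²s≤G = ℕ.≤-trans (ℕ.*-monoʳ-≤ (2 ℕ.* (n ℕ.* n)) (nonFull≤ {m})) poly≤G
    n≤G : n ℕ.≤ m !
    n≤G = 1+n≤n! m (ℕ.≤-trans (ℕ.s≤s (ℕ.s≤s (ℕ.s≤s ℕ.z≤n))) 127≤m)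

  ratio-close : ∀ m (ε : ℚ) → 0ℚ < ε → 127 ℕ.≤ m → 4 ℕ.* ↧ₙ ε ℕ.< suc m →
                ∣ ratio (suc m) - (1ℚ + 1ℚ) ∣ < ε
  ratio-close m ε 0<ε 127≤m =
    ∣b/g-2∣<ε (B (suc m)) (m !) {{m ℕ.!≢0}} ε 0<ε (suc m) (distance-from-2[n-1]! m 127≤m)

open import Data.Nat.Base as ℕ using (ℕ; suc; _≥_)
import Data.Nat.Properties as ℕ
open import Data.Product using (∃; _,_)
open import Data.Rational.Base using (ℚ; _<_; _-_; ∣_∣; 0ℚ; 1ℚ; _+_; ↧ₙ_)
open Asymptotics using (ratio-close)

-- N = 128 + 4q for ε = p/q: n ≥ 128 makes the symmetric permutations negligible, and n > 4q makes 4/n < ε.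
theorem8 : (ε : ℚ) → 0ℚ < ε →
    ∃ λ (N : ℕ) → (n : ℕ) → n ≥ N → n ≥ 1 → ∣ ratio n - (1ℚ + 1ℚ) ∣ < ε
theorem8 ε 0<ε = 128 ℕ.+ 4 ℕ.* ↧ₙ ε , close
  where
  close : (n : ℕ) → n ≥ 128 ℕ.+ 4 ℕ.* ↧ₙ ε → n ≥ 1 → ∣ ratio n - (1ℚ + 1ℚ) ∣ < ε
  close (suc m) n≥N _ = ratio-close m ε 0<ε
    (ℕ.s≤s⁻¹ (ℕ.≤-trans (ℕ.m≤m+n 128 (4 ℕ.* ↧ₙ ε)) n≥N))
    (ℕ.≤-trans (ℕ.s≤s (ℕ.m≤n+m (4 ℕ.* ↧ₙ ε) 127)) n≥N)
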